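{- Let $i\in[n]$ and let $C$ be an admissible column with $e_i(C)\neq 0$. Then $\mathrm{wt}(rC)=\mathrm{wt}(r(e_i(C)))$ or $\mathrm{wt}(rC)=s_i\,\mathrm{wt}(r(e_i(C)))$.
   Context: $[\pm n]=\{1,\dots,n,\overline n,\dots,\overline1\}$ ($\overline i=-i$), ordered $1<\dots<n<\overline n<\dots<\overline1$. A column is a strictly increasing sequence, read top to bottom as a word; admissible if whenever $i,\overline i$ both occur, with $i$ in row $a$ from the top and $\overline i$ in row $b$ from the bottom, $a+b\le i$. For admissible $C$ with $z_1>\dots>z_r$ the $z\in[n]$ with $z,\overline z\in C$, let $t_1$ be the greatest $t\in[n]$ with $t<z_1$, $t,\overline t\notin C$, and $t_k$ the greatest $t\in[n]$ with $t<\min(t_{k-1},z_k)$, $t,\overline t\notin C$; $rC$ replaces each $\overline{z_k}$ by $\overline{t_k}$ and reorders. $\mathrm{wt}$: $i$-th entry is number of $i$'s minus number of $\overline i$'s. $e_i$ (signature rule): replace letters in $\{i,\overline{i+1}\}$ by $+$, letters in $\{i+1,\overline i\}$ by $-$ ($i=n$: $n\mapsto+$, $\overline n\mapsto-$), cancel adjacent $+-$ pairs repeatedly; $e_i$ changes the letter of the rightmost uncancelled $-$ ($i+1\mapsto i$, $\overline i\mapsto\overline{i+1}$ for $i<n$; $\overline n\mapsto n$ for $i=n$), or is $0$ if none; on admissible columns it yields admissible columns. $s_i$ acts on $\mathbb Z^n$ by swapping entries $i,i+1$ ($i<n$) or negating entry $n$ ($i=n$). -}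

module Defs where

open import Data.Bool using (Bool; true; false; if_then_else_; _∧_; _∨_; not)
open import Data.Nat using (ℕ; zero; suc; _+_; _∸_; _≤_; _<_; _≡ᵇ_; _<ᵇ_; _⊓_)
open import Data.Integer as ℤ using (ℤ; +_)
open import Data.List using (List; []; _∷_; length; map; reverse; foldr; downFrom)
open import Data.List.Relation.Unary.All using (All)
open import Data.List.Relation.Unary.Linked using (Linked)
open import Data.Maybe using (Maybe; just; nothing)
open import Data.Product using (_×_; _,_)
open import Relation.Binary.PropositionalEquality using (_≡_)

-- Letters of [±n]:  pos i  is  i,  neg i  is  \overline i  (1 ≤ i ≤ n)

data Letter : Set where
  pos : ℕ → Letter
  neg : ℕ → Letter

index : Letter → ℕ
index (pos i) = i
index (neg i) = i

-- position in the order 1 < ... < n < \bar n < ... < \bar 1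
code : ℕ → Letter → ℕ
code n (pos i) = i
code n (neg i) = suc (n + n) ∸ i

ValidLetter : ℕ → Letter → Set
ValidLetter n l = 1 ≤ index l × index l ≤ n

-- A column: strictly increasing word (read top to bottom) in [±n]
Column : Set
Column = List Letter

IsColumn : ℕ → Column → Set
IsColumn n C = All (ValidLetter n) C × Linked (λ a b → code n a < code n b) C

-- k-th entry (0-indexed from the top)
nth : {A : Set} → List A → ℕ → Maybe A
nth []       _       = nothing
nth (x ∷ xs) zero    = just x
nth (x ∷ xs) (suc k) = nth xs k

-- Admissibility: if i is in row a from the top (a = p+1) and \bar i is in
-- row b from the bottom (b = length C - q), then a + b ≤ i.
Admissible : ℕ → Column → Set
Admissible n C = ∀ (p q j : ℕ) → nth C p ≡ just (pos j) → nth C q ≡ just (neg j)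
               → suc p + (length C ∸ q) ≤ j

anyᵇ : {A : Set} → (A → Bool) → List A → Bool
anyᵇ f []       = false
anyᵇ f (x ∷ xs) = f x ∨ anyᵇ f xs

filterᵇ : {A : Set} → (A → Bool) → List A → List A
filterᵇ f []       = []
filterᵇ f (x ∷ xs) = if f x then x ∷ filterᵇ f xs else filterᵇ f xs

isPos : ℕ → Letter → Bool
isPos j (pos i) = i ≡ᵇ j
isPos j (neg i) = false

isNeg : ℕ → Letter → Bool
isNeg j (pos i) = false
isNeg j (neg i) = i ≡ᵇ j

count : (Letter → Bool) → Column → ℕ
count f []       = 0
count f (x ∷ xs) = if f x then suc (count f xs) else count f xs

memPos memNeg : ℕ → Column → Bool
memPos j C = anyᵇ (isPos j) C
memNeg j C = anyᵇ (isNeg j) C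

oneTo : ℕ → List ℕ
oneTo n = reverse (map suc (downFrom n))

wt : ℕ → Column → List ℤ
wt n C = map (λ j → + count (isPos j) C ℤ.- + count (isNeg j) C) (oneTo n)

nDown : ℕ → List ℕ
nDown n = map suc (downFrom n)

-- z_1 > ... > z_r : the z ∈ [n] with z, \bar z ∈ C
zs : ℕ → Column → List ℕ
zs n C = filterᵇ (λ z → memPos z C ∧ memNeg z C) (nDown n)

free : ℕ → Column → Bool
free t C = not (memPos t C) ∧ not (memNeg t C)

-- greatest t ∈ [n] with t < b and t, \bar t ∉ C; returns 0 if none exists
-- (for admissible columns such t always exists, so the fallback is never used)
greatestFree : Column → ℕ → ℕ
greatestFree C zero          = 0
greatestFree C (suc zero)    = 0
greatestFree C (suc (suc b)) = if free (suc b) C then suc b else greatestFree C (suc b)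

-- list of pairs (z_k , t_k); prev is t_{k-1} (initially n+1, so min(prev,z_1) = z_1)
pairsFrom : Column → ℕ → List ℕ → List (ℕ × ℕ)
pairsFrom C prev []       = []
pairsFrom C prev (z ∷ zr) = let t = greatestFree C (prev ⊓ z) in (z , t) ∷ pairsFrom C t zr

replaceNeg : List (ℕ × ℕ) → Letter → Letter
replaceNeg []             l       = l
replaceNeg ((z , t) ∷ ps) (pos i) = pos i
replaceNeg ((z , t) ∷ ps) (neg i) = if i ≡ᵇ z then neg t else replaceNeg ps (neg i)

insert : ℕ → Letter → Column → Column
insert n l []       = l ∷ []
insert n l (x ∷ xs) = if code n l <ᵇ code n x then l ∷ x ∷ xs else x ∷ insert n l xs

sort : ℕ → Column → Column
sort n = foldr (insert n) []

r : ℕ → Column → Column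
r n C = sort n (map (replaceNeg (pairsFrom C (suc n) (zs n C))) C)

data Sign : Set where
  plus minus none : Sign

sign : ℕ → ℕ → Letter → Sign
sign n i (pos j) = if j ≡ᵇ i then plus
                   else if (i <ᵇ n) ∧ (j ≡ᵇ suc i) then minus else none
sign n i (neg j) = if j ≡ᵇ i then minus
                   else if (i <ᵇ n) ∧ (j ≡ᵇ suc i) then plus else none

-- scan left to right; 'open' = number of unmatched +'s so far;
-- returns the position (0-indexed) of the rightmost uncancelled −
scan : ℕ → ℕ → ℕ → ℕ → Maybe ℕ → Column → Maybe ℕ
scan n i pos' open' best []       = best
scan n i pos' open' best (x ∷ xs) with sign n i x
... | plus  = scan n i (suc pos') (suc open') best xs
... | none  = scan n i (suc pos') open' best xs
... | minus with open'
...   | zero     = scan n i (suc pos') zero (just pos') xs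
...   | suc o    = scan n i (suc pos') o best xs

change : ℕ → ℕ → Letter → Letter
change n i (pos j) = pos i            -- only applied to j = i+1 (i < n)
change n i (neg j) = if i <ᵇ n then neg (suc i) else pos n   -- j = i

modifyAt : {A : Set} → ℕ → (A → A) → List A → List A
modifyAt k       f []       = []
modifyAt zero    f (x ∷ xs) = f x ∷ xs
modifyAt (suc k) f (x ∷ xs) = x ∷ modifyAt k f xs

-- e_i(C); nothing represents 0
e : ℕ → ℕ → Column → Maybe Column
e n i C with scan n i 0 0 nothing C
... | nothing = nothing
... | just k  = just (modifyAt k (change n i) C)

-- s_i acting on Z^n (as lists of length n)

swapAt : {A : Set} → ℕ → List A → List A
swapAt zero    (x ∷ y ∷ xs) = y ∷ x ∷ xs
swapAt (suc k) (x ∷ xs)     = x ∷ swapAt k xs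
swapAt _       xs           = xs

s : ℕ → ℕ → List ℤ → List ℤ
s n i v = if i <ᵇ n then swapAt (i ∸ 1) v else modifyAt (n ∸ 1) ℤ.-_ v

-- The profile of a column X at j is the pair (number of j, number of j̄) in X.  The map r keeps
-- every letter except the barred halves z̄ of the pairs z, z̄ ∈ X, which become t̄_k; so the j-th
-- weight of rX depends only on the profile of X at j and on how often j occurs among the t_k.
-- For i < n, e_i changes only the profiles at i and i + 1, and the signature rule leaves six
-- configurations.  In four of them e_i exchanges the two profiles and the t_k are permuted by the
-- transposition of i and i + 1, so wt(rC) = s_i wt(r e_i C).  In the other two, one of C, e_i C has
-- i free and i + 1 paired while the other has single letters at both; the first has exactly one
-- extra t_k, equal to i, and the weights at i and i + 1 are compared directly.  Finally e_n turns
-- n̄ into n, which changes neither free positions nor pairs and negates the n-th weight.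

module Submission where

open import Defs
open import Data.Bool using (Bool; true; false; if_then_else_; _∧_; not)
open import Data.Bool.Properties using (∨-zeroʳ; ∧-zeroʳ; T-≡)
open import Data.Nat using (ℕ; zero; suc; _≤_; _<_; _+_; _∸_; _⊓_; _≡ᵇ_; _<ᵇ_; z≤n; s≤s)
open import Data.Nat.Properties
open import Data.Integer as ℤ using (ℤ)
open import Algebra.Properties.CommutativeSemigroup +-commutativeSemigroup using (x∙yz≈y∙xz; xy∙z≈zy∙x; xy∙z≈y∙xz)
open import Data.List using (List; []; _∷_; map; _++_; reverse; downFrom; applyUpTo; applyDownFrom)
open import Data.List.Properties using (map-downFrom; reverse-applyDownFrom; map-applyUpTo)
open import Data.List.Relation.Unary.All as All using (All; []; _∷_)
open import Data.List.Relation.Unary.AllPairs using (AllPairs; []; _∷_)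
open import Data.List.Relation.Unary.Linked using ([]; [-]; _∷_)
open import Data.List.Relation.Unary.Linked.Properties using (Linked⇒AllPairs)
open import Data.List.Relation.Unary.Any using (here; there)
open import Data.List.Membership.Propositional using (_∈_)
open import Data.Maybe using (Maybe; just; nothing)
open import Data.Product using (_×_; _,_; proj₁; proj₂; Σ; ∃; map₁)
open import Data.Sum using (_⊎_; inj₁; inj₂)
open import Data.Empty using (⊥-elim)
open import Function using (_∘_; Equivalence)
open import Relation.Binary.PropositionalEquality
open import Relation.Nullary using (yes; no)
open import Relation.Binary.Definitions using (tri<; tri≈; tri>)
open import Relation.Nullary.Decidable using (dec-true; dec-false)

bit : Bool → ℕ
bit true  = 1
bit false = 0

nonzero : ℕ → Bool
nonzero zero    = false
nonzero (suc _) = true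

true≢false : true ≢ false
true≢false ()

≡ᵇ-refl : ∀ m → (m ≡ᵇ m) ≡ true
≡ᵇ-refl m = dec-true (m ≟ m) refl

≢⇒≡ᵇ-false : ∀ {m n} → m ≢ n → (m ≡ᵇ n) ≡ false
≢⇒≡ᵇ-false {m} {n} = dec-false (m ≟ n)

≡ᵇ-true⇒≡ : ∀ {m n} → (m ≡ᵇ n) ≡ true → m ≡ n
≡ᵇ-true⇒≡ {m} {n} eq = ≡ᵇ⇒≡ m n (Equivalence.from T-≡ eq)

<⇒<ᵇ-true : ∀ {m n} → m < n → (m <ᵇ n) ≡ true
<⇒<ᵇ-true m<n = Equivalence.to T-≡ (<⇒<ᵇ m<n)

<ᵇ-irrefl : ∀ n → (n <ᵇ n) ≡ false
<ᵇ-irrefl zero    = refl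
<ᵇ-irrefl (suc n) = <ᵇ-irrefl n

if-true : ∀ {A : Set} {b} {x y : A} → b ≡ true → (if b then x else y) ≡ x
if-true refl = refl

if-false : ∀ {A : Set} {b} {x y : A} → b ≡ false → (if b then x else y) ≡ y
if-false refl = refl

count-∷ : ∀ f x xs → count f (x ∷ xs) ≡ bit (f x) + count f xs
count-∷ f x xs with f x
... | true  = refl
... | false = refl

count-cong : ∀ {f g} xs → All (λ x → f x ≡ g x) xs → count f xs ≡ count g xs
count-cong [] [] = refl
count-cong {f} {g} (x ∷ xs) (fx≡gx ∷ eqs)
  rewrite count-∷ f x xs | count-∷ g x xs | fx≡gx | count-cong xs eqs = refl

count-zero : ∀ {f} xs → All (λ x → f x ≡ false) xs → count f xs ≡ 0
count-zero [] [] = refl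
count-zero {f} (x ∷ xs) (fx ∷ fxs) rewrite count-∷ f x xs | fx = count-zero xs fxs

count-zero⁻ : ∀ f xs → count f xs ≡ 0 → All (λ x → f x ≡ false) xs
count-zero⁻ f [] _ = []
count-zero⁻ f (x ∷ xs) eq with f x in fx
... | false = fx ∷ count-zero⁻ f xs eq

count-map : ∀ f g xs → count f (map g xs) ≡ count (f ∘ g) xs
count-map f g [] = refl
count-map f g (x ∷ xs)
  rewrite count-∷ f (g x) (map g xs) | count-∷ (f ∘ g) x xs | count-map f g xs = refl

count-insert : ∀ n f l xs → count f (insert n l xs) ≡ count f (l ∷ xs)
count-insert n f l [] = refl
count-insert n f l (x ∷ xs) with code n l <ᵇ code n x
... | true  = refl
... | false rewrite count-∷ f x (insert n l xs) | count-insert n f l xs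
                  | count-∷ f l xs | count-∷ f l (x ∷ xs) | count-∷ f x xs
  = x∙yz≈y∙xz (bit (f x)) (bit (f l)) (count f xs)

count-sort : ∀ n f xs → count f (sort n xs) ≡ count f xs
count-sort n f [] = refl
count-sort n f (x ∷ xs)
  rewrite count-insert n f x (sort n xs) | count-∷ f x (sort n xs) | count-∷ f x xs | count-sort n f xs = refl

count-modifyAt : ∀ f h k xs {x} → nth xs k ≡ just x →
  count f (modifyAt k h xs) + bit (f x) ≡ count f xs + bit (f (h x))
count-modifyAt f h zero (y ∷ xs) refl rewrite count-∷ f (h y) xs | count-∷ f y xs
  = xy∙z≈zy∙x (bit (f (h y))) (count f xs) (bit (f y))
count-modifyAt f h (suc k) (y ∷ xs) eq rewrite count-∷ f y (modifyAt k h xs) | count-∷ f y xs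
  = trans (+-assoc (bit (f y)) _ _) (trans (cong (bit (f y) +_) (count-modifyAt f h k xs eq)) (sym (+-assoc (bit (f y)) _ _)))

anyᵇ≡nonzero-count : ∀ f xs → anyᵇ f xs ≡ nonzero (count f xs)
anyᵇ≡nonzero-count f [] = refl
anyᵇ≡nonzero-count f (x ∷ xs) with f x
... | true  = refl
... | false = anyᵇ≡nonzero-count f xs

multiplicity : ℕ → List ℕ → ℕ
multiplicity j []       = 0
multiplicity j (t ∷ ts) = bit (t ≡ᵇ j) + multiplicity j ts

multiplicity-absent : ∀ {j} ts → All (λ t → t ≢ j) ts → multiplicity j ts ≡ 0
multiplicity-absent [] [] = refl
multiplicity-absent (t ∷ ts) (t≢j ∷ rest) rewrite ≢⇒≡ᵇ-false t≢j = multiplicity-absent ts rest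

multiplicity-filterᵇ-true : ∀ f j ts → f j ≡ true → multiplicity j (filterᵇ f ts) ≡ multiplicity j ts
multiplicity-filterᵇ-true f j [] _ = refl
multiplicity-filterᵇ-true f j (t ∷ ts) fj with f t in ft | t ≟ j
... | true  | _ = cong (bit (t ≡ᵇ j) +_) (multiplicity-filterᵇ-true f j ts fj)
... | false | yes refl = ⊥-elim (true≢false (trans (sym fj) ft))
... | false | no t≢j rewrite ≢⇒≡ᵇ-false t≢j = multiplicity-filterᵇ-true f j ts fj

multiplicity-filterᵇ-false : ∀ f j ts → f j ≡ false → multiplicity j (filterᵇ f ts) ≡ 0
multiplicity-filterᵇ-false f j [] _ = refl
multiplicity-filterᵇ-false f j (t ∷ ts) fj with f t in ft | t ≟ j
... | false | _ = multiplicity-filterᵇ-false f j ts fj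
... | true  | yes refl = ⊥-elim (true≢false (trans (sym ft) fj))
... | true  | no t≢j rewrite ≢⇒≡ᵇ-false t≢j = multiplicity-filterᵇ-false f j ts fj

filterᵇ-All : ∀ {A : Set} {P : A → Set} f xs → All P xs → All P (filterᵇ f xs)
filterᵇ-All f [] [] = []
filterᵇ-All f (x ∷ xs) (px ∷ pxs) with f x
... | true  = px ∷ filterᵇ-All f xs pxs
... | false = filterᵇ-All f xs pxs

filterᵇ-satisfies : ∀ {A : Set} (f : A → Bool) xs → All (λ x → f x ≡ true) (filterᵇ f xs)
filterᵇ-satisfies f [] = []
filterᵇ-satisfies f (x ∷ xs) with f x in fx
... | true  = fx ∷ filterᵇ-satisfies f xs
... | false = filterᵇ-satisfies f xs

filterᵇ-AllPairs : ∀ {A : Set} {R : A → A → Set} f xs → AllPairs R xs → AllPairs R (filterᵇ f xs)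
filterᵇ-AllPairs f [] [] = []
filterᵇ-AllPairs f (x ∷ xs) (rx ∷ rxs) with f x
... | true  = filterᵇ-All f xs rx ∷ filterᵇ-AllPairs f xs rxs
... | false = filterᵇ-AllPairs f xs rxs

filterᵇ-++ : ∀ {A : Set} (f : A → Bool) xs ys → filterᵇ f (xs ++ ys) ≡ filterᵇ f xs ++ filterᵇ f ys
filterᵇ-++ f []       ys = refl
filterᵇ-++ f (x ∷ xs) ys with f x
... | true  = cong (x ∷_) (filterᵇ-++ f xs ys)
... | false = filterᵇ-++ f xs ys

filterᵇ-cong : ∀ {A : Set} {f g : A → Bool} xs → All (λ x → f x ≡ g x) xs → filterᵇ f xs ≡ filterᵇ g xs
filterᵇ-cong []       []            = refl
filterᵇ-cong (x ∷ xs) (fx≡gx ∷ eqs) rewrite fx≡gx | filterᵇ-cong xs eqs = refl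

∈-filterᵇ⁺ : ∀ {A : Set} (f : A → Bool) {x xs} → x ∈ xs → f x ≡ true → x ∈ filterᵇ f xs
∈-filterᵇ⁺ f {xs = y ∷ xs} (here refl) fx rewrite fx = here refl
∈-filterᵇ⁺ f {xs = y ∷ xs} (there x∈xs) fx with f y
... | true  = there (∈-filterᵇ⁺ f x∈xs fx)
... | false = ∈-filterᵇ⁺ f x∈xs fx

∈-filterᵇ⁻ : ∀ {A : Set} (f : A → Bool) {x} xs → x ∈ filterᵇ f xs → x ∈ xs × f x ≡ true
∈-filterᵇ⁻ f (y ∷ xs) x∈ with f y in fy
∈-filterᵇ⁻ f (y ∷ xs) (here refl) | true = here refl , fy
∈-filterᵇ⁻ f (y ∷ xs) (there x∈) | true = map₁ there (∈-filterᵇ⁻ f xs x∈)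
... | false = map₁ there (∈-filterᵇ⁻ f xs x∈)

Strict : ℕ → Column → Set
Strict n = AllPairs (λ a b → code n a < code n b)

code-key-unique : ∀ n (f : Letter → Bool) c → (∀ y → f y ≡ true → code n y ≡ c) →
  ∀ {x y} → f x ≡ true → code n x < code n y → f y ≡ false
code-key-unique n f c same {x} {y} fx x<y with f y in fy
... | false = refl
... | true  = ⊥-elim (<-irrefl (trans (same x fx) (sym (same y fy))) x<y)

count-≤1 : ∀ n (f : Letter → Bool) c xs → (∀ y → f y ≡ true → code n y ≡ c) → Strict n xs → count f xs ≤ 1
count-≤1 n f c [] _ _ = z≤n
count-≤1 n f c (x ∷ xs) same (x<xs ∷ strict) rewrite count-∷ f x xs with f x in fx
... | false = count-≤1 n f c xs same strict
... | true rewrite count-zero {f} xs (All.map (code-key-unique n f c same fx) x<xs) = s≤s z≤n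

strict-unique : ∀ n {L M} → Strict n L → Strict n M → (∀ {x} → x ∈ L → x ∈ M) → (∀ {x} → x ∈ M → x ∈ L) → L ≡ M
strict-unique n {[]} {[]} _ _ _ _ = refl
strict-unique n {[]} {y ∷ M} _ _ _ M⊆L with M⊆L (here refl)
... | ()
strict-unique n {x ∷ L} {[]} _ _ L⊆M _ with L⊆M (here refl)
... | ()
strict-unique n {x ∷ L} {y ∷ M} (x<L ∷ sL) (y<M ∷ sM) L⊆M M⊆L = cong₂ _∷_ x≡y (strict-unique n sL sM L⊆M′ M⊆L′)
  where
  x≡y : x ≡ y
  x≡y with L⊆M (here refl) | M⊆L (here refl)
  ... | here eq  | _        = eq
  ... | there _  | here eq  = sym eq
  ... | there y<… | there x<… = ⊥-elim (<-asym (All.lookup y<M y<…) (All.lookup x<L x<…))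
  L⊆M′ : ∀ {z} → z ∈ L → z ∈ M
  L⊆M′ z∈L with L⊆M (there z∈L)
  ... | there z∈M = z∈M
  ... | here refl = ⊥-elim (<-irrefl (cong (code n) x≡y) (All.lookup x<L z∈L))
  M⊆L′ : ∀ {z} → z ∈ M → z ∈ L
  M⊆L′ z∈M with M⊆L (there z∈M)
  ... | there z∈L = z∈L
  ... | here refl = ⊥-elim (<-irrefl (cong (code n) (sym x≡y)) (All.lookup y<M z∈M))

isPos-true : ∀ j y → isPos j y ≡ true → y ≡ pos j
isPos-true j (pos i) eq = cong pos (≡ᵇ-true⇒≡ eq)

isNeg-true : ∀ j y → isNeg j y ≡ true → y ≡ neg j
isNeg-true j (neg i) eq = cong neg (≡ᵇ-true⇒≡ eq)

memL : Letter → Column → Bool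
memL (pos j) C = memPos j C
memL (neg j) C = memNeg j C

∈⇒memL : ∀ {x} C → x ∈ C → memL x C ≡ true
∈⇒memL {pos j} (y ∷ C) (here refl) rewrite ≡ᵇ-refl j = refl
∈⇒memL {neg j} (y ∷ C) (here refl) rewrite ≡ᵇ-refl j = refl
∈⇒memL {pos j} (y ∷ C) (there x∈C) rewrite ∈⇒memL C x∈C = ∨-zeroʳ _
∈⇒memL {neg j} (y ∷ C) (there x∈C) rewrite ∈⇒memL C x∈C = ∨-zeroʳ _

memL⇒∈ : ∀ x C → memL x C ≡ true → x ∈ C
memL⇒∈ (pos j) (y ∷ C) mem with isPos j y in py
... | true  = here (sym (isPos-true j y py))
... | false = there (memL⇒∈ (pos j) C mem)
memL⇒∈ (neg j) (y ∷ C) mem with isNeg j y in ny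
... | true  = here (sym (isNeg-true j y ny))
... | false = there (memL⇒∈ (neg j) C mem)

profile : Column → ℕ → ℕ × ℕ
profile X j = count (isPos j) X , count (isNeg j) X

NegativesDistinct : Column → Set
NegativesDistinct X = ∀ j → count (isNeg j) X ≤ 1

column-pos-≤1 : ∀ {n X} → IsColumn n X → ∀ j → count (isPos j) X ≤ 1
column-pos-≤1 {n} (_ , linked) j =
  count-≤1 n (isPos j) j _ (λ y eq → cong (code n) (isPos-true j y eq)) (Linked⇒AllPairs <-trans linked)

column-neg-≤1 : ∀ {n X} → IsColumn n X → NegativesDistinct X
column-neg-≤1 {n} (_ , linked) j =
  count-≤1 n (isNeg j) (code n (neg j)) _ (λ y eq → cong (code n) (isNeg-true j y eq)) (Linked⇒AllPairs <-trans linked)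

bit-nonzero : ∀ {c} → c ≤ 1 → c ≡ bit (nonzero c)
bit-nonzero z≤n       = refl
bit-nonzero (s≤s z≤n) = refl

profile-column : ∀ {n X} → IsColumn n X → ∀ j → profile X j ≡ (bit (memPos j X) , bit (memNeg j X))
profile-column {X = X} col j rewrite anyᵇ≡nonzero-count (isPos j) X | anyᵇ≡nonzero-count (isNeg j) X
  = cong₂ _,_ (bit-nonzero (column-pos-≤1 col j)) (bit-nonzero (column-neg-≤1 col j))

freeᵖ bothᵖ : ℕ × ℕ → Bool
freeᵖ (p , q) = not (nonzero p) ∧ not (nonzero q)

bothᵖ (p , q) = nonzero p ∧ nonzero q

hasBoth : Column → ℕ → Bool
hasBoth X z = memPos z X ∧ memNeg z X

Single : ℕ × ℕ → Set
Single a = freeᵖ a ≡ false × bothᵖ a ≡ false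

freeᵖ⇒¬bothᵖ : ∀ a → freeᵖ a ≡ true → bothᵖ a ≡ false
freeᵖ⇒¬bothᵖ (zero  , zero)  _ = refl
freeᵖ⇒¬bothᵖ (zero  , suc _) ()
freeᵖ⇒¬bothᵖ (suc _ , _)     ()

bothᵖ⇒¬freeᵖ : ∀ a → bothᵖ a ≡ true → freeᵖ a ≡ false
bothᵖ⇒¬freeᵖ (suc _ , suc _) _ = refl

free-profile : ∀ X j → free j X ≡ freeᵖ (profile X j)
free-profile X j rewrite anyᵇ≡nonzero-count (isPos j) X | anyᵇ≡nonzero-count (isNeg j) X = refl

hasBoth-profile : ∀ X j → hasBoth X j ≡ bothᵖ (profile X j)
hasBoth-profile X j rewrite anyᵇ≡nonzero-count (isPos j) X | anyᵇ≡nonzero-count (isNeg j) X = refl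

free-from-profile : ∀ X Y {s t} → profile Y s ≡ profile X t → free s Y ≡ free t X
free-from-profile X Y {s} {t} eq = trans (free-profile Y s) (trans (cong freeᵖ eq) (sym (free-profile X t)))

hasBoth-from-profile : ∀ X Y {s t} → profile Y s ≡ profile X t → hasBoth Y s ≡ hasBoth X t
hasBoth-from-profile X Y {s} {t} eq = trans (hasBoth-profile Y s) (trans (cong bothᵖ eq) (sym (hasBoth-profile X t)))

-- The weight of rX

Decreasing : List ℕ → Set
Decreasing = AllPairs (λ a b → b < a)

nDown-bounds : ∀ m → All (λ w → 1 ≤ w × w ≤ m) (nDown m)
nDown-bounds zero    = []
nDown-bounds (suc m) = (s≤s z≤n , ≤-refl) ∷ All.map (λ (1≤w , w≤m) → 1≤w , m≤n⇒m≤1+n w≤m) (nDown-bounds m)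

nDown-decreasing : ∀ m → Decreasing (nDown m)
nDown-decreasing zero    = []
nDown-decreasing (suc m) = All.map (λ (_ , w≤m) → s≤s w≤m) (nDown-bounds m) ∷ nDown-decreasing m

multiplicity-nDown : ∀ {j} m → 1 ≤ j → j ≤ m → multiplicity j (nDown m) ≡ 1
multiplicity-nDown zero 1≤j j≤0 = ⊥-elim (<-irrefl refl (≤-trans 1≤j j≤0))
multiplicity-nDown {j} (suc m) 1≤j j≤1+m with suc m ≟ j
... | yes refl rewrite ≡ᵇ-refl (suc m) =
  cong suc (multiplicity-absent (nDown m) (All.map (λ (_ , w≤m) w≡j → <-irrefl w≡j (s≤s w≤m)) (nDown-bounds m)))
... | no 1+m≢j rewrite ≢⇒≡ᵇ-false 1+m≢j =
  multiplicity-nDown m 1≤j (≤-pred (≤∧≢⇒< j≤1+m (λ j≡1+m → 1+m≢j (sym j≡1+m))))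

zs-decreasing : ∀ n X → Decreasing (zs n X)
zs-decreasing n X = filterᵇ-AllPairs (hasBoth X) (nDown n) (nDown-decreasing n)

zs-hasBoth : ∀ n X → All (λ z → hasBoth X z ≡ true) (zs n X)
zs-hasBoth n X = filterᵇ-satisfies (hasBoth X) (nDown n)

zs-cong : ∀ n X Y → (∀ z → hasBoth Y z ≡ hasBoth X z) → zs n Y ≡ zs n X
zs-cong n X Y agree = filterᵇ-cong (nDown n) (All.tabulate (λ {z} _ → agree z))

multiplicity-zs : ∀ n X {j} → 1 ≤ j → j ≤ n → multiplicity j (zs n X) ≡ bit (hasBoth X j)
multiplicity-zs n X {j} 1≤j j≤n with hasBoth X j in both
... | true  = trans (multiplicity-filterᵇ-true (hasBoth X) j (nDown n) both) (multiplicity-nDown n 1≤j j≤n)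
... | false = multiplicity-filterᵇ-false (hasBoth X) j (nDown n) both

proj₁-pairsFrom : ∀ X p zl → map proj₁ (pairsFrom X p zl) ≡ zl
proj₁-pairsFrom X p []       = refl
proj₁-pairsFrom X p (z ∷ zl) = cong (z ∷_) (proj₁-pairsFrom X _ zl)

replaceNeg-pos : ∀ ps i → replaceNeg ps (pos i) ≡ pos i
replaceNeg-pos []      i = refl
replaceNeg-pos (_ ∷ _) i = refl

isPos-replaceNeg : ∀ ps j x → isPos j (replaceNeg ps x) ≡ isPos j x
isPos-replaceNeg ps j (pos i) rewrite replaceNeg-pos ps i = refl
isPos-replaceNeg [] j (neg i) = refl
isPos-replaceNeg ((z , t) ∷ ps) j (neg i) with i ≡ᵇ z
... | true  = refl
... | false = isPos-replaceNeg ps j (neg i)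

replaceNeg-other : ∀ z t ps x → isNeg z x ≡ false → replaceNeg ((z , t) ∷ ps) x ≡ replaceNeg ps x
replaceNeg-other z t ps (pos i) _    = sym (replaceNeg-pos ps i)
replaceNeg-other z t ps (neg i) i≢z rewrite i≢z = refl

replaceNeg-absent : ∀ z ps → All (λ w → w ≢ z) (map proj₁ ps) → replaceNeg ps (neg z) ≡ neg z
replaceNeg-absent z [] _ = refl
replaceNeg-absent z ((w , t) ∷ ps) (w≢z ∷ rest) rewrite ≢⇒≡ᵇ-false (w≢z ∘ sym) = replaceNeg-absent z ps rest

count-unique-change : ∀ (f g : Letter → Bool) z X → count (isNeg z) X ≡ 1 →
  (∀ x → isNeg z x ≡ false → f x ≡ g x) → count f X + bit (g (neg z)) ≡ count g X + bit (f (neg z))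
count-unique-change f g z (x ∷ X) once agree with isNeg z x in xz
... | true rewrite isNeg-true z x xz | count-∷ f (neg z) X | count-∷ g (neg z) X
                 | count-cong {f} {g} X (All.map (λ x̸z → agree _ x̸z) (count-zero⁻ (isNeg z) X (suc-injective once)))
  = xy∙z≈zy∙x (bit (f (neg z))) (count g X) (bit (g (neg z)))
... | false rewrite count-∷ f x X | count-∷ g x X | agree x xz
  = trans (+-assoc (bit (g x)) _ _) (trans (cong (bit (g x) +_) (count-unique-change f g z X once agree)) (sym (+-assoc (bit (g x)) _ _)))

count-replaceNeg : ∀ ps X j → Decreasing (map proj₁ ps) → All (λ z → count (isNeg z) X ≡ 1) (map proj₁ ps) →
  count (isNeg j ∘ replaceNeg ps) X + multiplicity j (map proj₁ ps) ≡ count (isNeg j) X + multiplicity j (map proj₂ ps)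
count-replaceNeg [] X j _ _ = refl
count-replaceNeg ((z , t) ∷ ps) X j (z>ps ∷ decr) (once ∷ onces) = begin
  A + (bit (z ≡ᵇ j) + mZ)    ≡⟨ sym (+-assoc A _ mZ) ⟩
  A + bit (z ≡ᵇ j) + mZ      ≡⟨ cong (_+ mZ) swap ⟩
  A′ + bit (t ≡ᵇ j) + mZ     ≡⟨ xy∙z≈y∙xz A′ _ mZ ⟩
  bit (t ≡ᵇ j) + (A′ + mZ)   ≡⟨ cong (bit (t ≡ᵇ j) +_) (count-replaceNeg ps X j decr onces) ⟩
  bit (t ≡ᵇ j) + (count (isNeg j) X + multiplicity j (map proj₂ ps))   ≡⟨ x∙yz≈y∙xz (bit (t ≡ᵇ j)) (count (isNeg j) X) _ ⟩
  count (isNeg j) X + (bit (t ≡ᵇ j) + multiplicity j (map proj₂ ps))   ∎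
  where
  open ≡-Reasoning
  A  = count (isNeg j ∘ replaceNeg ((z , t) ∷ ps)) X
  A′ = count (isNeg j ∘ replaceNeg ps) X
  mZ = multiplicity j (map proj₁ ps)
  untouched : isNeg j (replaceNeg ps (neg z)) ≡ (z ≡ᵇ j)
  untouched rewrite replaceNeg-absent z ps (All.map (λ w<z w≡z → <-irrefl w≡z w<z) z>ps) = refl
  replaced : isNeg j (replaceNeg ((z , t) ∷ ps) (neg z)) ≡ (t ≡ᵇ j)
  replaced rewrite ≡ᵇ-refl z = refl
  swap : A + bit (z ≡ᵇ j) ≡ A′ + bit (t ≡ᵇ j)
  swap = subst₂ (λ u v → A + bit u ≡ A′ + bit v) untouched replaced
           (count-unique-change (isNeg j ∘ replaceNeg ((z , t) ∷ ps)) (isNeg j ∘ replaceNeg ps) z X once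
             (λ x x̸z → cong (isNeg j) (replaceNeg-other z t ps x x̸z)))

replacements : ℕ → Column → List (ℕ × ℕ)
replacements n X = pairsFrom X (suc n) (zs n X)

tList : ℕ → Column → List ℕ
tList n X = map proj₂ (replacements n X)

tcount : ℕ → Column → ℕ → ℕ
tcount n X j = multiplicity j (tList n X)

W : Column → ℕ → ℤ
W X j = ℤ.+ count (isPos j) X ℤ.- ℤ.+ count (isNeg j) X

-- A paired j̄ is replaced, and each t_k = j contributes a t̄_k.
ρ : ℕ × ℕ → ℕ → ℤ
ρ (p , q) t = ℤ.+ p ℤ.- ℤ.+ (q + t ∸ bit (bothᵖ (p , q)))

hasBoth-once : ∀ X z → NegativesDistinct X → hasBoth X z ≡ true → count (isNeg z) X ≡ 1
hasBoth-once X z distinct both with memPos z X | memNeg z X in neg∈X | both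
... | true | true | refl = trans (bit-nonzero (distinct z)) (cong bit (trans (sym (anyᵇ≡nonzero-count (isNeg z) X)) neg∈X))

count-pos-r : ∀ n X j → count (isPos j) (r n X) ≡ count (isPos j) X
count-pos-r n X j = trans (count-sort n (isPos j) (map (replaceNeg ps) X)) (trans (count-map (isPos j) (replaceNeg ps) X)
  (count-cong X (All.tabulate (λ {x} _ → isPos-replaceNeg ps j x))))
  where ps = replacements n X

count-neg-r : ∀ n X {j} → NegativesDistinct X → 1 ≤ j → j ≤ n →
  count (isNeg j) (r n X) + bit (hasBoth X j) ≡ count (isNeg j) X + tcount n X j
count-neg-r n X {j} distinct 1≤j j≤n =
  subst (λ m → count (isNeg j) (r n X) + m ≡ count (isNeg j) X + tcount n X j)
    (trans (cong (multiplicity j) (proj₁-pairsFrom X (suc n) (zs n X))) (multiplicity-zs n X 1≤j j≤n))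
    (subst (λ c → c + multiplicity j (map proj₁ ps) ≡ count (isNeg j) X + tcount n X j)
       (sym (trans (count-sort n (isNeg j) (map (replaceNeg ps) X)) (count-map (isNeg j) (replaceNeg ps) X)))
       (count-replaceNeg ps X j decr onces))
  where
  ps = replacements n X
  decr : Decreasing (map proj₁ ps)
  decr rewrite proj₁-pairsFrom X (suc n) (zs n X) = zs-decreasing n X
  onces : All (λ z → count (isNeg z) X ≡ 1) (map proj₁ ps)
  onces rewrite proj₁-pairsFrom X (suc n) (zs n X) = All.map (hasBoth-once X _ distinct) (zs-hasBoth n X)

W-r : ∀ n X {j} → NegativesDistinct X → 1 ≤ j → j ≤ n → W (r n X) j ≡ ρ (profile X j) (tcount n X j)
W-r n X {j} distinct 1≤j j≤n = cong₂ (λ p q → ℤ.+ p ℤ.- ℤ.+ q) (count-pos-r n X j) negatives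
  where
  negatives : count (isNeg j) (r n X) ≡ count (isNeg j) X + tcount n X j ∸ bit (bothᵖ (profile X j))
  negatives = begin
    count (isNeg j) (r n X)                                    ≡⟨ sym (m+n∸n≡m _ (bit (hasBoth X j))) ⟩
    count (isNeg j) (r n X) + bit (hasBoth X j) ∸ bit (hasBoth X j)
      ≡⟨ cong₂ _∸_ (count-neg-r n X distinct 1≤j j≤n) (cong bit (hasBoth-profile X j)) ⟩
    count (isNeg j) X + tcount n X j ∸ bit (bothᵖ (profile X j))   ∎
    where open ≡-Reasoning

W-r-at : ∀ n X {j a t} → NegativesDistinct X → 1 ≤ j → j ≤ n → profile X j ≡ a → tcount n X j ≡ t → W (r n X) j ≡ ρ a t
W-r-at n X distinct 1≤j j≤n refl refl = W-r n X distinct 1≤j j≤n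

-- The transposition of i and i + 1

tau : ℕ → ℕ → ℕ
tau i j = if j ≡ᵇ i then suc i else (if j ≡ᵇ suc i then i else j)

suc≢ : ∀ i → suc i ≢ i
suc≢ i eq = <-irrefl (sym eq) ≤-refl

tau-i : ∀ i → tau i i ≡ suc i
tau-i i rewrite ≡ᵇ-refl i = refl

tau-suc : ∀ i → tau i (suc i) ≡ i
tau-suc i rewrite ≢⇒≡ᵇ-false (suc≢ i) | ≡ᵇ-refl (suc i) = refl

tau-other : ∀ i {j} → j ≢ i → j ≢ suc i → tau i j ≡ j
tau-other i j≢i j≢1+i rewrite ≢⇒≡ᵇ-false j≢i | ≢⇒≡ᵇ-false j≢1+i = refl

tau-below : ∀ i {j} → j < i → tau i j ≡ j
tau-below i j<i = tau-other i (λ eq → <-irrefl eq j<i) (λ eq → <-irrefl eq (m≤n⇒m≤1+n j<i))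

tau-above : ∀ i {j} → suc i < j → tau i j ≡ j
tau-above i 1+i<j = tau-other i (λ eq → <-irrefl (sym eq) (<-trans ≤-refl 1+i<j)) (λ eq → <-irrefl (sym eq) 1+i<j)

window-cases : ∀ (P : ℕ → Set) i → (∀ j → j ≢ i → j ≢ suc i → P j) → P i → P (suc i) → ∀ j → P j
window-cases P i outside at-i at-suc j with j ≟ i | j ≟ suc i
... | yes refl | _        = at-i
... | no _     | yes refl = at-suc
... | no j≢i   | no j≢1+i = outside j j≢i j≢1+i

tau-pointwise : ∀ {A : Set} (f g : ℕ → A) i → (∀ j → j ≢ i → j ≢ suc i → f j ≡ g j) →
  f i ≡ g (suc i) → f (suc i) ≡ g i → ∀ j → f j ≡ g (tau i j)
tau-pointwise f g i outside at-i at-suc = window-cases (λ j → f j ≡ g (tau i j)) i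
  (λ j j≢i j≢1+i → trans (outside j j≢i j≢1+i) (cong g (sym (tau-other i j≢i j≢1+i))))
  (trans at-i (cong g (sym (tau-i i)))) (trans at-suc (cong g (sym (tau-suc i))))

tau-involutive : ∀ i j → tau i (tau i j) ≡ j
tau-involutive i j = sym (tau-pointwise (λ j → j) (tau i) i
  (λ j j≢i j≢1+i → sym (tau-other i j≢i j≢1+i)) (sym (tau-suc i)) (sym (tau-i i)) j)

tau-invariant : ∀ {A : Set} (f : ℕ → A) i → f i ≡ f (suc i) → ∀ z → f (tau i z) ≡ f z
tau-invariant f i same z = sym (tau-pointwise f f i (λ _ _ _ → refl) same (sym same) z)

tau-bounds : ∀ {n i j} → 1 ≤ i → i < n → 1 ≤ j → j ≤ n → 1 ≤ tau i j × tau i j ≤ n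
tau-bounds {n} {i} {j} 1≤i i<n 1≤j j≤n with j ≟ i | j ≟ suc i
... | yes refl | _        rewrite tau-i j   = s≤s z≤n , i<n
... | no _     | yes refl rewrite tau-suc i = 1≤i , <⇒≤ i<n
... | no j≢i   | no j≢1+i rewrite tau-other i j≢i j≢1+i = 1≤j , j≤n

tau-suc-suc : ∀ k j → tau (suc k) (suc j) ≡ suc (tau k j)
tau-suc-suc k j with j ≡ᵇ k | j ≡ᵇ suc k
... | true  | _     = refl
... | false | true  = refl
... | false | false = refl

tau-≤-outside : ∀ i {p z} → z ≢ i → p ≤ z → tau i p ≤ z
tau-≤-outside i {p} z≢i p≤z with p ≟ i | p ≟ suc i
... | yes refl | _        rewrite tau-i p   = ≤∧≢⇒< p≤z (λ p≡z → z≢i (sym p≡z))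
... | no _     | yes refl rewrite tau-suc i = ≤-trans (n≤1+n i) p≤z
... | no p≢i   | no p≢1+i rewrite tau-other i p≢i p≢1+i = p≤z

tau-≥-outside : ∀ i {p z} → z ≢ i → z ≢ suc i → z ≤ p → z ≤ tau i p
tau-≥-outside i {p} z≢i z≢1+i z≤p with p ≟ i | p ≟ suc i
... | yes refl | _        rewrite tau-i p   = m≤n⇒m≤1+n z≤p
... | no _     | yes refl rewrite tau-suc i = ≤-pred (≤∧≢⇒< z≤p z≢1+i)
... | no p≢i   | no p≢1+i rewrite tau-other i p≢i p≢1+i = z≤p

tau-⊓ : ∀ i p {z} → z ≢ i → z ≢ suc i → tau i p ⊓ z ≡ tau i (p ⊓ z)
tau-⊓ i p {z} z≢i z≢1+i with ≤-total p z
... | inj₁ p≤z rewrite m≤n⇒m⊓n≡m p≤z = m≤n⇒m⊓n≡m (tau-≤-outside i z≢i p≤z)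
... | inj₂ z≤p rewrite m≥n⇒m⊓n≡n z≤p | tau-other i z≢i z≢1+i = m≥n⇒m⊓n≡n (tau-≥-outside i z≢i z≢1+i z≤p)

≡ᵇ-tau : ∀ i t j → (tau i t ≡ᵇ j) ≡ (t ≡ᵇ tau i j)
≡ᵇ-tau i t j with t ≟ tau i j
... | yes refl rewrite tau-involutive i j | ≡ᵇ-refl j | ≡ᵇ-refl (tau i j) = refl
... | no t≢τj rewrite ≢⇒≡ᵇ-false t≢τj
  = ≢⇒≡ᵇ-false {tau i t} {j} (λ τt≡j → t≢τj (trans (sym (tau-involutive i t)) (cong (tau i) τt≡j)))

multiplicity-map-tau : ∀ i j ts → multiplicity j (map (tau i) ts) ≡ multiplicity (tau i j) ts
multiplicity-map-tau i j []       = refl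
multiplicity-map-tau i j (t ∷ ts) rewrite ≡ᵇ-tau i t j | multiplicity-map-tau i j ts = refl

map-tau-fixed : ∀ i ts → All (λ t → t ≢ i × t ≢ suc i) ts → map (tau i) ts ≡ ts
map-tau-fixed i []       []                    = refl
map-tau-fixed i (t ∷ ts) ((t≢i , t≢1+i) ∷ rest) = cong₂ _∷_ (tau-other i t≢i t≢1+i) (map-tau-fixed i ts rest)

map-tau-involutive : ∀ i ts → map (tau i) (map (tau i) ts) ≡ ts
map-tau-involutive i []       = refl
map-tau-involutive i (t ∷ ts) = cong₂ _∷_ (tau-involutive i t) (map-tau-involutive i ts)

-- Greatest free values and the list of the t_k

gf-unfold : ∀ X {c} → 1 ≤ c → greatestFree X (suc c) ≡ (if free c X then c else greatestFree X c)
gf-unfold X {suc c} _ = refl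

gf-cong : ∀ X Y b → (∀ t → t < b → free t X ≡ free t Y) → greatestFree X b ≡ greatestFree Y b
gf-cong X Y zero          _     = refl
gf-cong X Y (suc zero)    _     = refl
gf-cong X Y (suc (suc b)) agree = cong₂ (λ c g → if c then suc b else g)
  (agree (suc b) ≤-refl) (gf-cong X Y (suc b) (λ t t<1+b → agree t (m≤n⇒m≤1+n t<1+b)))

gf-≤ : ∀ X b → greatestFree X b ≤ b
gf-≤ X zero          = z≤n
gf-≤ X (suc zero)    = z≤n
gf-≤ X (suc (suc b)) with gf-≤ X (suc b) | free (suc b) X
... | _  | true  = n≤1+n _
... | ih | false = m≤n⇒m≤1+n ih

gf-< : ∀ X b → 1 ≤ b → greatestFree X b < b
gf-< X (suc zero)    _ = s≤s z≤n
gf-< X (suc (suc b)) _ with gf-< X (suc b) (s≤s z≤n) | free (suc b) X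
... | _  | true  = ≤-refl
... | ih | false = m≤n⇒m≤1+n ih

gf-free : ∀ X b → greatestFree X b ≡ 0 ⊎ free (greatestFree X b) X ≡ true
gf-free X zero          = inj₁ refl
gf-free X (suc zero)    = inj₁ refl
gf-free X (suc (suc b)) with gf-free X (suc b) | free (suc b) X in fb
... | _  | true  = inj₂ fb
... | ih | false = ih

gf-≥ : ∀ X t b → free t X ≡ true → 1 ≤ t → t < b → t ≤ greatestFree X b
gf-≥ X t (suc zero) ft 1≤t t<1 = ⊥-elim (<-irrefl refl (≤-trans t<1 1≤t))
gf-≥ X t (suc (suc b)) ft 1≤t t<b with gf-≥ X t (suc b) ft 1≤t | free (suc b) X in fb | t ≟ suc b
... | _  | true  | _        = ≤-pred t<b
... | _  | false | yes refl = ⊥-elim (true≢false (trans (sym ft) fb))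
... | ih | false | no t≢1+b = ih (≤∧≢⇒< (≤-pred t<b) t≢1+b)

gf-≢-nonfree : ∀ X b {u} → 1 ≤ u → free u X ≡ false → greatestFree X b ≢ u
gf-≢-nonfree X b 1≤u fu eq with gf-free X b
... | inj₁ gf≡0 = <-irrefl (trans (sym gf≡0) eq) 1≤u
... | inj₂ free-gf = true≢false (trans (sym free-gf) (trans (cong (λ w → free w X) eq) fu))

pairsFrom-cong : ∀ X Y → (∀ t → free t Y ≡ free t X) → ∀ p zl → pairsFrom Y p zl ≡ pairsFrom X p zl
pairsFrom-cong X Y agree p []       = refl
pairsFrom-cong X Y agree p (z ∷ zl) rewrite gf-cong Y X (p ⊓ z) (λ t _ → agree t) = cong (_ ∷_) (pairsFrom-cong X Y agree _ zl)

pairsFrom-free : ∀ X p zl → All (λ t → t ≡ 0 ⊎ free t X ≡ true) (map proj₂ (pairsFrom X p zl))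
pairsFrom-free X p []       = []
pairsFrom-free X p (z ∷ zl) = gf-free X (p ⊓ z) ∷ pairsFrom-free X _ zl

tList-avoids-nonfree : ∀ n X {u} → 1 ≤ u → free u X ≡ false → All (_≢ u) (tList n X)
tList-avoids-nonfree n X 1≤u nonfree = All.map avoid (pairsFrom-free X (suc n) (zs n X))
  where
  avoid : ∀ {t} → t ≡ 0 ⊎ free t X ≡ true → t ≢ _
  avoid (inj₁ refl) 0≡u = <-irrefl 0≡u 1≤u
  avoid (inj₂ free-t) refl = true≢false (trans (sym free-t) nonfree)

tcount-nonfree : ∀ n X {j} → 1 ≤ j → free j X ≡ false → tcount n X j ≡ 0
tcount-nonfree n X 1≤j nonfree = multiplicity-absent (tList n X) (tList-avoids-nonfree n X 1≤j nonfree)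

tList-tau-fixed : ∀ n X i → 1 ≤ i → free i X ≡ false → free (suc i) X ≡ false → map (tau i) (tList n X) ≡ tList n X
tList-tau-fixed n X i 1≤i nonfree-i nonfree-suc = map-tau-fixed i (tList n X)
  (All.zip (tList-avoids-nonfree n X 1≤i nonfree-i , tList-avoids-nonfree n X (s≤s z≤n) nonfree-suc))

module Conjugation (X Y : Column) (i : ℕ) (1≤i : 1 ≤ i)
                   (free-i : free i X ≡ true) (nonfree-suc : free (suc i) X ≡ false)
                   (free-tau : ∀ t → free t Y ≡ free (tau i t) X) where

  private
    free-fixed : ∀ {t} → tau i t ≡ t → free t Y ≡ free t X
    free-fixed {t} τt≡t = trans (free-tau t) (cong (λ w → free w X) τt≡t)

  gf-below : ∀ b → b ≤ i → greatestFree Y b ≡ greatestFree X b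
  gf-below b b≤i = gf-cong Y X b (λ t t<b → free-fixed (tau-below i (<-≤-trans t<b b≤i)))

  gf-first-above : greatestFree Y (suc (suc i)) ≡ tau i (greatestFree X (suc (suc i)))
  gf-first-above = begin
    greatestFree Y (suc (suc i))   ≡⟨ if-true (trans (free-tau (suc i)) (trans (cong (λ w → free w X) (tau-suc i)) free-i)) ⟩
    suc i                          ≡⟨ sym (tau-i i) ⟩
    tau i i                        ≡⟨ cong (tau i) (sym (trans (gf-unfold X 1≤i) (if-true free-i))) ⟩
    tau i (greatestFree X (suc i)) ≡⟨ cong (tau i) (sym (if-false nonfree-suc)) ⟩
    tau i (greatestFree X (suc (suc i))) ∎
    where open ≡-Reasoning

  gf-above : ∀ c → suc i ≤ c → greatestFree Y (suc c) ≡ tau i (greatestFree X (suc c))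
  gf-above (suc c) 1+i≤1+c with m≤n⇒m<n∨m≡n 1+i≤1+c
  ... | inj₂ refl = gf-first-above
  ... | inj₁ 1+i<1+c with gf-above c (≤-pred 1+i<1+c) | free (suc c) X in fc
  ...   | _  | true  rewrite free-fixed (tau-above i 1+i<1+c) | fc = sym (tau-above i 1+i<1+c)
  ...   | ih | false rewrite free-fixed (tau-above i 1+i<1+c) | fc = ih

  gf-tau : ∀ b → b ≢ suc i → greatestFree Y (tau i b) ≡ tau i (greatestFree X b)
  gf-tau b b≢1+i with <-cmp b i
  ... | tri< b<i _ _ rewrite tau-below i b<i =
    trans (gf-below b (<⇒≤ b<i)) (sym (tau-below i (≤-<-trans (gf-≤ X b) b<i)))
  ... | tri≈ _ refl _ rewrite tau-i b = begin
    greatestFree Y (suc b)   ≡⟨ gf-unfold Y 1≤i ⟩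
    _                        ≡⟨ if-false (trans (free-tau b) (trans (cong (λ w → free w X) (tau-i b)) nonfree-suc)) ⟩
    greatestFree Y b         ≡⟨ gf-below b ≤-refl ⟩
    greatestFree X b         ≡⟨ sym (tau-below b (gf-< X b 1≤i)) ⟩
    tau b (greatestFree X b) ∎
    where open ≡-Reasoning
  ... | tri> _ _ b>i with b | m≤n⇒m<n∨m≡n b>i
  ...   | _     | inj₂ 1+i≡b = ⊥-elim (b≢1+i (sym 1+i≡b))
  ...   | suc c | inj₁ 1+i<1+c rewrite tau-above i 1+i<1+c = gf-above c (≤-pred 1+i<1+c)

  pairsFrom-tau : ∀ p zl → p ≢ suc i → All (λ z → z ≢ i × z ≢ suc i) zl →
    map proj₂ (pairsFrom Y (tau i p) zl) ≡ map (tau i) (map proj₂ (pairsFrom X p zl))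
  pairsFrom-tau p []       _      _                          = refl
  pairsFrom-tau p (z ∷ zl) p≢1+i ((z≢i , z≢1+i) ∷ outside) = cong₂ _∷_ step
    (trans (cong (λ q → map proj₂ (pairsFrom Y q zl)) step)
           (pairsFrom-tau (greatestFree X (p ⊓ z)) zl (gf-≢-nonfree X (p ⊓ z) (s≤s z≤n) nonfree-suc) outside))
    where
    p⊓z≢1+i : p ⊓ z ≢ suc i
    p⊓z≢1+i with ⊓-sel p z
    ... | inj₁ eq = subst (_≢ suc i) (sym eq) p≢1+i
    ... | inj₂ eq = subst (_≢ suc i) (sym eq) z≢1+i
    step : greatestFree Y (tau i p ⊓ z) ≡ tau i (greatestFree X (p ⊓ z))
    step = trans (cong (greatestFree Y) (tau-⊓ i p z≢i z≢1+i)) (gf-tau (p ⊓ z) p⊓z≢1+i)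

gf-window : ∀ X i p → 1 ≤ i → free i X ≡ false → greatestFree X (p ⊓ suc i) ≡ greatestFree X (p ⊓ i)
gf-window X i p 1≤i nonfree-i with ≤-total p i
... | inj₁ p≤i rewrite m≤n⇒m⊓n≡m (m≤n⇒m≤1+n p≤i) | m≤n⇒m⊓n≡m p≤i = refl
... | inj₂ i≤p with m≤n⇒m<n∨m≡n i≤p
...   | inj₂ refl rewrite m≤n⇒m⊓n≡m (n≤1+n i) | ⊓-idem i = refl
...   | inj₁ i<p rewrite m≥n⇒m⊓n≡n i<p | m≥n⇒m⊓n≡n i≤p = trans (gf-unfold X 1≤i) (if-false nonfree-i)

pairsFrom-window : ∀ X i p A B → 1 ≤ i → free i X ≡ false →
  map proj₂ (pairsFrom X p (A ++ suc i ∷ B)) ≡ map proj₂ (pairsFrom X p (A ++ i ∷ B))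
pairsFrom-window X i p []      B 1≤i nonfree-i rewrite gf-window X i p 1≤i nonfree-i = refl
pairsFrom-window X i p (z ∷ A) B 1≤i nonfree-i =
  cong (greatestFree X (p ⊓ z) ∷_) (pairsFrom-window X i (greatestFree X (p ⊓ z)) A B 1≤i nonfree-i)

module Insertion (X Y : Column) (i : ℕ) (1≤i : 1 ≤ i)
                 (free-i : free i Y ≡ true) (nonfree-i : free i X ≡ false) (nonfree-suc : free (suc i) X ≡ false)
                 (free-other : ∀ t → t ≢ i → free t Y ≡ free t X) where

  TX TY : ℕ → List ℕ → List ℕ
  TX p zl = map proj₂ (pairsFrom X p zl)
  TY p zl = map proj₂ (pairsFrom Y p zl)

  gf-below : ∀ b → b ≤ i → greatestFree Y b ≡ greatestFree X b
  gf-below b b≤i = gf-cong Y X b (λ t t<b → free-other t (λ t≡i → <-irrefl t≡i (<-≤-trans t<b b≤i)))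

  gf-split : ∀ b → greatestFree Y b ≡ greatestFree X b ⊎ (greatestFree Y b ≡ i × greatestFree X b ≡ greatestFree X i)
  gf-split zero          = inj₁ refl
  gf-split (suc zero)    = inj₁ refl
  gf-split (suc (suc c)) with gf-split (suc c) | suc c ≟ i
  ... | _  | yes refl = inj₂ (if-true free-i , if-false nonfree-i)
  ... | ih | no c≢i rewrite free-other (suc c) c≢i with free (suc c) X
  ...   | true  = inj₁ refl
  ...   | false = ih

  tails-below : ∀ p q B → All (_< i) B → p ≡ q ⊎ (i ≤ p × i ≤ q) → TY p B ≡ TX q B
  tails-below p q []      _            _    = refl
  tails-below p q (z ∷ B) (z<i ∷ B<i) bound = cong₂ _∷_ step (tails-below _ _ B B<i (inj₁ step))
    where
    same-min : p ≡ q ⊎ (i ≤ p × i ≤ q) → p ⊓ z ≡ q ⊓ z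
    same-min (inj₁ refl) = refl
    same-min (inj₂ (i≤p , i≤q)) =
      trans (m≥n⇒m⊓n≡n (≤-trans (<⇒≤ z<i) i≤p)) (sym (m≥n⇒m⊓n≡n (≤-trans (<⇒≤ z<i) i≤q)))
    step : greatestFree Y (p ⊓ z) ≡ greatestFree X (q ⊓ z)
    step = trans (gf-below (p ⊓ z) (≤-trans (m⊓n≤n p z) (<⇒≤ z<i))) (cong (greatestFree X) (same-min bound))

  -- Once Y has chosen the new free value i, it stays one step behind X.
  lagging : ∀ A B p → All (suc i <_) A → All (_< i) B → p ≤ i →
    TY p (A ++ suc i ∷ B) ≡ greatestFree X p ∷ TX (greatestFree X p) (A ++ B)
  lagging [] B p _ B<i p≤i rewrite m≤n⇒m⊓n≡m (m≤n⇒m≤1+n p≤i) | gf-below p p≤i =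
    cong (greatestFree X p ∷_) (tails-below _ _ B B<i (inj₁ refl))
  lagging (z ∷ A) B p (i<z ∷ A>i) B<i p≤i
    rewrite m≤n⇒m⊓n≡m (≤-trans p≤i (<⇒≤ (<-trans ≤-refl i<z))) | gf-below p p≤i
          | m≤n⇒m⊓n≡m (≤-trans (gf-≤ X p) (≤-trans p≤i (<⇒≤ (<-trans ≤-refl i<z))))
    = cong (greatestFree X p ∷_) (lagging A B (greatestFree X p) A>i B<i (≤-trans (gf-≤ X p) p≤i))

  gf-agree-above : ∀ b → i < b → greatestFree Y b ≡ greatestFree X b → i < greatestFree X b
  gf-agree-above b i<b agree = ≤∧≢⇒< (subst (i ≤_) agree (gf-≥ Y i b free-i 1≤i i<b))
                               (λ i≡gf → gf-≢-nonfree X b 1≤i nonfree-i (sym i≡gf))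

  multiplicity-inserted : ∀ A B p → All (suc i <_) A → All (_< i) B → i < p → ∀ j →
    multiplicity j (TY p (A ++ suc i ∷ B)) ≡ bit (i ≡ᵇ j) + multiplicity j (TX p (A ++ B))
  multiplicity-inserted [] B p _ B<i i<p j
    rewrite m≥n⇒m⊓n≡n i<p | trans (gf-unfold Y 1≤i) (if-true free-i) | tails-below i p B B<i (inj₂ (≤-refl , <⇒≤ i<p))
    = refl
  multiplicity-inserted (z ∷ A) B p (i<z ∷ A>i) B<i i<p j with gf-split (p ⊓ z)
  ... | inj₁ agree
    rewrite agree | multiplicity-inserted A B _ A>i B<i (gf-agree-above (p ⊓ z) (⊓-glb i<p (<-trans ≤-refl i<z)) agree) j
    = x∙yz≈y∙xz (bit (greatestFree X (p ⊓ z) ≡ᵇ j)) (bit (i ≡ᵇ j)) _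
  ... | inj₂ (Y≡i , X≡gfi) rewrite Y≡i | X≡gfi | lagging A B i A>i B<i ≤-refl = refl

nDown-prefix : ∀ {k m} → k ≤ m → Σ (List ℕ) λ A → nDown m ≡ A ++ nDown k × All (k <_) A
nDown-prefix {m = zero} z≤n = [] , refl , []
nDown-prefix {k} {suc m} k≤1+m with m≤n⇒m<n∨m≡n k≤1+m
... | inj₂ refl = [] , refl , []
... | inj₁ k<1+m with nDown-prefix {k} {m} (≤-pred k<1+m)
...   | A , split , bound = suc m ∷ A , cong (suc m ∷_) split , k<1+m ∷ bound

nDown-window : ∀ {n i} → 1 ≤ i → i < n →
  Σ (List ℕ) λ A → Σ (List ℕ) λ B → nDown n ≡ A ++ suc i ∷ i ∷ B × All (suc i <_) A × All (_< i) B
nDown-window {n} {suc i} _ 1+i<n with nDown-prefix {suc (suc i)} {n} 1+i<n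
... | A , split , bound = A , nDown i , split , bound , All.map (λ (_ , w≤i) → s≤s w≤i) (nDown-bounds i)

module Window {n i : ℕ} (1≤i : 1 ≤ i) (i<n : i < n) where

  private
    window = nDown-window 1≤i i<n
    A = proj₁ window
    B = proj₁ (proj₂ window)
    A>1+i = proj₁ (proj₂ (proj₂ (proj₂ window)))
    B<i   = proj₂ (proj₂ (proj₂ (proj₂ window)))

  above below : Column → List ℕ
  above X = filterᵇ (hasBoth X) A
  below X = filterᵇ (hasBoth X) B

  above-bound : ∀ X → All (suc i <_) (above X)
  above-bound X = filterᵇ-All (hasBoth X) A A>1+i

  below-bound : ∀ X → All (_< i) (below X)
  below-bound X = filterᵇ-All (hasBoth X) B B<i

  zs-split : ∀ X → zs n X ≡ above X ++ filterᵇ (hasBoth X) (suc i ∷ i ∷ []) ++ below X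
  zs-split X = begin
    zs n X                                               ≡⟨ cong (filterᵇ (hasBoth X)) (proj₁ (proj₂ (proj₂ window))) ⟩
    filterᵇ (hasBoth X) (A ++ (suc i ∷ i ∷ []) ++ B)     ≡⟨ filterᵇ-++ (hasBoth X) A _ ⟩
    above X ++ filterᵇ (hasBoth X) ((suc i ∷ i ∷ []) ++ B) ≡⟨ cong (above X ++_) (filterᵇ-++ (hasBoth X) (suc i ∷ i ∷ []) B) ⟩
    above X ++ filterᵇ (hasBoth X) (suc i ∷ i ∷ []) ++ below X ∎
    where open ≡-Reasoning

  zs-window-suc : ∀ X → hasBoth X (suc i) ≡ true → hasBoth X i ≡ false → zs n X ≡ above X ++ suc i ∷ below X
  zs-window-suc X hs hi rewrite zs-split X | hs | hi = refl

  zs-window-i : ∀ X → hasBoth X (suc i) ≡ false → hasBoth X i ≡ true → zs n X ≡ above X ++ i ∷ below X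
  zs-window-i X hs hi rewrite zs-split X | hs | hi = refl

  zs-window-none : ∀ X → hasBoth X (suc i) ≡ false → hasBoth X i ≡ false → zs n X ≡ above X ++ below X
  zs-window-none X hs hi rewrite zs-split X | hs | hi = refl

  outside-same : ∀ X Y → (∀ z → z ≢ i → z ≢ suc i → hasBoth Y z ≡ hasBoth X z) → above Y ≡ above X × below Y ≡ below X
  outside-same X Y agree =
      filterᵇ-cong A (All.map (λ 1+i<z → agree _ (λ z≡i → <-irrefl (sym z≡i) (<-trans ≤-refl 1+i<z))
                                                 (λ z≡1+i → <-irrefl (sym z≡1+i) 1+i<z)) A>1+i)
    , filterᵇ-cong B (All.map (λ z<i → agree _ (λ z≡i → <-irrefl z≡i z<i)
                                               (λ z≡1+i → <-irrefl z≡1+i (m≤n⇒m≤1+n z<i))) B<i)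

conjugate-tList : ∀ n i X Y → 1 ≤ i → i < n → (∀ t → profile Y t ≡ profile X (tau i t)) →
  freeᵖ (profile X i) ≡ true → Single (profile X (suc i)) → tList n Y ≡ map (tau i) (tList n X)
conjugate-tList n i X Y 1≤i i<n τ-profile free-i (nonfree-suc , unpaired-suc) = begin
  map proj₂ (pairsFrom Y (suc n) (zs n Y))           ≡⟨ cong (λ zl → map proj₂ (pairsFrom Y (suc n) zl)) (zs-cong n X Y same-pairs) ⟩
  map proj₂ (pairsFrom Y (suc n) (zs n X))           ≡⟨ cong (λ p → map proj₂ (pairsFrom Y p (zs n X))) (sym (tau-above i (s≤s i<n))) ⟩
  map proj₂ (pairsFrom Y (tau i (suc n)) (zs n X))   ≡⟨ Conjugation.pairsFrom-tau X Y i 1≤i free-Xi free-X1+i free-tau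
                                                          (suc n) (zs n X) (λ eq → <-irrefl (sym eq) (s≤s i<n)) avoid ⟩
  map (tau i) (tList n X)                            ∎
  where
  open ≡-Reasoning
  free-Xi = trans (free-profile X i) free-i
  free-X1+i = trans (free-profile X (suc i)) nonfree-suc
  unpaired-i : hasBoth X i ≡ false
  unpaired-i = trans (hasBoth-profile X i) (freeᵖ⇒¬bothᵖ (profile X i) free-i)
  unpaired-1+i : hasBoth X (suc i) ≡ false
  unpaired-1+i = trans (hasBoth-profile X (suc i)) unpaired-suc
  free-tau : ∀ t → free t Y ≡ free (tau i t) X
  free-tau t = free-from-profile X Y (τ-profile t)
  same-pairs : ∀ z → hasBoth Y z ≡ hasBoth X z
  same-pairs z = trans (hasBoth-from-profile X Y (τ-profile z)) (tau-invariant (hasBoth X) i (trans unpaired-i (sym unpaired-1+i)) z)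
  avoid : All (λ z → z ≢ i × z ≢ suc i) (zs n X)
  avoid = All.map (λ {z} paired → (λ { refl → true≢false (trans (sym paired) unpaired-i) })
                                , (λ { refl → true≢false (trans (sym paired) unpaired-1+i) }))
                  (zs-hasBoth n X)

relabel-tList : ∀ n i X Y → 1 ≤ i → i < n → (∀ t → profile Y t ≡ profile X (tau i t)) →
  freeᵖ (profile X i) ≡ false → freeᵖ (profile X (suc i)) ≡ false → tList n Y ≡ map (tau i) (tList n X)
relabel-tList n i X Y 1≤i i<n τ-profile nonfree-i nonfree-suc = begin
  map proj₂ (pairsFrom Y (suc n) (zs n Y))   ≡⟨ cong (map proj₂) (pairsFrom-cong X Y same-free (suc n) (zs n Y)) ⟩
  map proj₂ (pairsFrom X (suc n) (zs n Y))   ≡⟨ same-pairs (hasBoth X (suc i)) (hasBoth X i) refl refl ⟩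
  tList n X                                   ≡⟨ sym (tList-tau-fixed n X i 1≤i free-Xi free-X1+i) ⟩
  map (tau i) (tList n X)                     ∎
  where
  open ≡-Reasoning
  open Window 1≤i i<n
  free-Xi = trans (free-profile X i) nonfree-i
  free-X1+i = trans (free-profile X (suc i)) nonfree-suc
  same-free : ∀ t → free t Y ≡ free t X
  same-free t = trans (free-from-profile X Y (τ-profile t)) (tau-invariant (λ t → free t X) i (trans free-Xi (sym free-X1+i)) t)
  pairs-tau : ∀ z → hasBoth Y z ≡ hasBoth X (tau i z)
  pairs-tau z = hasBoth-from-profile X Y (τ-profile z)
  outside = outside-same X Y (λ z z≢i z≢1+i → trans (pairs-tau z) (cong (hasBoth X) (tau-other i z≢i z≢1+i)))
  Y-at-suc : hasBoth Y (suc i) ≡ hasBoth X i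
  Y-at-suc = trans (pairs-tau (suc i)) (cong (hasBoth X) (tau-suc i))
  Y-at-i : hasBoth Y i ≡ hasBoth X (suc i)
  Y-at-i = trans (pairs-tau i) (cong (hasBoth X) (tau-i i))
  zs-Y : ∀ {A} → zs n Y ≡ above Y ++ A → zs n Y ≡ above X ++ A
  zs-Y {A} eq = trans eq (cong (_++ A) (proj₁ outside))
  unchanged : hasBoth X i ≡ hasBoth X (suc i) →
    map proj₂ (pairsFrom X (suc n) (zs n Y)) ≡ map proj₂ (pairsFrom X (suc n) (zs n X))
  unchanged same = cong (λ zl → map proj₂ (pairsFrom X (suc n) zl))
    (zs-cong n X Y (λ z → trans (pairs-tau z) (tau-invariant (hasBoth X) i same z)))
  same-pairs : ∀ a b → hasBoth X (suc i) ≡ a → hasBoth X i ≡ b →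
    map proj₂ (pairsFrom X (suc n) (zs n Y)) ≡ map proj₂ (pairsFrom X (suc n) (zs n X))
  same-pairs true false hs hi
    rewrite zs-window-suc X hs hi | zs-Y (zs-window-i Y (trans Y-at-suc hi) (trans Y-at-i hs)) | proj₂ outside
    = sym (pairsFrom-window X i (suc n) (above X) (below X) 1≤i free-Xi)
  same-pairs false true hs hi
    rewrite zs-window-i X hs hi | zs-Y (zs-window-suc Y (trans Y-at-suc hi) (trans Y-at-i hs)) | proj₂ outside
    = pairsFrom-window X i (suc n) (above X) (below X) 1≤i free-Xi
  same-pairs true  true  hs hi = unchanged (trans hi (sym hs))
  same-pairs false false hs hi = unchanged (trans hi (sym hs))

insert-tcount : ∀ n i X Y → 1 ≤ i → i < n → (∀ t → t ≢ i → t ≢ suc i → profile Y t ≡ profile X t) →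
  freeᵖ (profile Y i) ≡ true → bothᵖ (profile Y (suc i)) ≡ true → Single (profile X i) → Single (profile X (suc i)) →
  ∀ j → tcount n Y j ≡ bit (i ≡ᵇ j) + tcount n X j
insert-tcount n i X Y 1≤i i<n outside free-i paired-suc (nonfree-i , unpaired-i) (nonfree-suc , unpaired-suc) j = begin
  multiplicity j (ts Y (zs n Y))                           ≡⟨ cong (multiplicity j ∘ ts Y) zs-Y ⟩
  multiplicity j (ts Y (above X ++ suc i ∷ below X))       ≡⟨ Insertion.multiplicity-inserted X Y i 1≤i
                                                               (trans (free-profile Y i) free-i) free-Xi free-X1+i free-other
                                                               (above X) (below X) (suc n) (above-bound X) (below-bound X) (s≤s (<⇒≤ i<n)) j ⟩
  bit (i ≡ᵇ j) + multiplicity j (ts X (above X ++ below X)) ≡⟨ cong (λ zl → bit (i ≡ᵇ j) + multiplicity j (ts X zl)) (sym zs-X) ⟩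
  bit (i ≡ᵇ j) + tcount n X j                             ∎
  where
  open ≡-Reasoning
  open Window 1≤i i<n
  ts : Column → List ℕ → List ℕ
  ts Z zl = map proj₂ (pairsFrom Z (suc n) zl)
  free-Xi = trans (free-profile X i) nonfree-i
  free-X1+i = trans (free-profile X (suc i)) nonfree-suc
  same-filters = outside-same X Y (λ z z≢i z≢1+i → hasBoth-from-profile X Y (outside z z≢i z≢1+i))
  zs-Y : zs n Y ≡ above X ++ suc i ∷ below X
  zs-Y = trans (zs-window-suc Y (trans (hasBoth-profile Y (suc i)) paired-suc)
                                (trans (hasBoth-profile Y i) (freeᵖ⇒¬bothᵖ (profile Y i) free-i)))
               (cong₂ (λ a b → a ++ suc i ∷ b) (proj₁ same-filters) (proj₂ same-filters))
  zs-X : zs n X ≡ above X ++ below X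
  zs-X = zs-window-none X (trans (hasBoth-profile X (suc i)) unpaired-suc) (trans (hasBoth-profile X i) unpaired-i)
  free-other : ∀ t → t ≢ i → free t Y ≡ free t X
  free-other t t≢i with t ≟ suc i
  ... | yes refl = trans (free-profile Y t) (trans (bothᵖ⇒¬freeᵖ (profile Y t) paired-suc) (sym free-X1+i))
  ... | no t≢1+i = free-from-profile X Y (outside t t≢i t≢1+i)

applyUpTo-cong : ∀ {A : Set} {f g : ℕ → A} m → (∀ j → j < m → f j ≡ g j) → applyUpTo f m ≡ applyUpTo g m
applyUpTo-cong zero    _     = refl
applyUpTo-cong (suc m) agree = cong₂ _∷_ (agree 0 (s≤s z≤n)) (applyUpTo-cong m (λ j j<m → agree (suc j) (s≤s j<m)))

swapAt-applyUpTo : ∀ {A : Set} (f : ℕ → A) k m → suc k < m → swapAt k (applyUpTo f m) ≡ applyUpTo (f ∘ tau k) m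
swapAt-applyUpTo f zero    (suc (suc m)) _            = refl
swapAt-applyUpTo f zero    (suc zero)    (s≤s ())
swapAt-applyUpTo f (suc k) (suc m)       (s≤s 1+k<m) = cong (f 0 ∷_)
  (trans (swapAt-applyUpTo (f ∘ suc) k m 1+k<m) (applyUpTo-cong m (λ j _ → cong f (sym (tau-suc-suc k j)))))

modifyAt-applyUpTo : ∀ {A : Set} (f g : ℕ → A) h k → (∀ j → j < k → g j ≡ f j) → g k ≡ h (f k) →
  modifyAt k h (applyUpTo f (suc k)) ≡ applyUpTo g (suc k)
modifyAt-applyUpTo f g h zero    _     at-k = cong (_∷ []) (sym at-k)
modifyAt-applyUpTo f g h (suc k) below at-k = cong₂ _∷_ (sym (below 0 (s≤s z≤n)))
  (modifyAt-applyUpTo (f ∘ suc) (g ∘ suc) h k (λ j j<k → below (suc j) (s≤s j<k)) at-k)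

wt-applyUpTo : ∀ n A → wt n A ≡ applyUpTo (W A ∘ suc) n
wt-applyUpTo n A = begin
  map (W A) (reverse (map suc (downFrom n)))  ≡⟨ cong (map (W A) ∘ reverse) (map-downFrom suc n) ⟩
  map (W A) (reverse (applyDownFrom suc n))   ≡⟨ cong (map (W A)) (reverse-applyDownFrom suc n) ⟩
  map (W A) (applyUpTo suc n)                 ≡⟨ map-applyUpTo suc (W A) n ⟩
  applyUpTo (W A ∘ suc) n                     ∎
  where open ≡-Reasoning

wt-cong : ∀ n A B → (∀ j → 1 ≤ j → j ≤ n → W A j ≡ W B j) → wt n A ≡ wt n B
wt-cong n A B agree rewrite wt-applyUpTo n A | wt-applyUpTo n B =
  applyUpTo-cong n (λ j j<n → agree (suc j) (s≤s z≤n) j<n)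

wt-swap : ∀ n i A B → 1 ≤ i → i < n → (∀ j → 1 ≤ j → j ≤ n → W A j ≡ W B (tau i j)) → wt n A ≡ s n i (wt n B)
wt-swap n (suc k) A B _ 1+k<n related rewrite <⇒<ᵇ-true 1+k<n | wt-applyUpTo n A | wt-applyUpTo n B
  | swapAt-applyUpTo (W B ∘ suc) k n 1+k<n
  = applyUpTo-cong n (λ j j<n → trans (related (suc j) (s≤s z≤n) j<n) (cong (W B) (tau-suc-suc k j)))

wt-negate-last : ∀ n A B → 1 ≤ n → (∀ j → 1 ≤ j → j < n → W A j ≡ W B j) → W A n ≡ ℤ.- W B n →
  wt n A ≡ s n n (wt n B)
wt-negate-last (suc k) A B _ below at-n rewrite <ᵇ-irrefl k | wt-applyUpTo (suc k) A | wt-applyUpTo (suc k) B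
  = sym (modifyAt-applyUpTo (W B ∘ suc) (W A ∘ suc) ℤ.-_ k (λ j j<k → below (suc j) (s≤s z≤n) (s≤s j<k)) at-n)

swap-by-profile : ∀ n i X Y → 1 ≤ i → i < n → NegativesDistinct X → (∀ t → profile Y t ≡ profile X (tau i t)) →
  tList n Y ≡ map (tau i) (tList n X) → wt n (r n X) ≡ s n i (wt n (r n Y))
swap-by-profile n i X Y 1≤i i<n distinct τ-profile τ-tList = wt-swap n i (r n X) (r n Y) 1≤i i<n pointwise
  where
  distinct-Y : NegativesDistinct Y
  distinct-Y t = subst (_≤ 1) (sym (cong proj₂ (τ-profile t))) (distinct (tau i t))
  pointwise : ∀ j → 1 ≤ j → j ≤ n → W (r n X) j ≡ W (r n Y) (tau i j)
  pointwise j 1≤j j≤n = trans (W-r n X distinct 1≤j j≤n)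
    (sym (W-r-at n Y distinct-Y (proj₁ τ-bounds) (proj₂ τ-bounds)
      (trans (τ-profile (tau i j)) (cong (profile X) (tau-involutive i j)))
      (trans (cong (multiplicity (tau i j)) τ-tList)
             (trans (multiplicity-map-tau i (tau i j) (tList n X)) (cong (λ u → multiplicity u (tList n X)) (tau-involutive i j))))))
    where τ-bounds = tau-bounds 1≤i i<n 1≤j j≤n

distinct-window : ∀ X Y i → NegativesDistinct X → (∀ t → t ≢ i → t ≢ suc i → profile Y t ≡ profile X t) →
  ∀ {p q p′ q′} → profile Y i ≡ (p , q) → profile Y (suc i) ≡ (p′ , q′) → q ≤ 1 → q′ ≤ 1 → NegativesDistinct Y
distinct-window X Y i distinct outside w₀ w₁ q≤1 q′≤1 = window-cases (λ t → count (isNeg t) Y ≤ 1) i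
  (λ t t≢i t≢1+i → subst (_≤ 1) (sym (cong proj₂ (outside t t≢i t≢1+i))) (distinct t))
  (subst (_≤ 1) (sym (cong proj₂ w₀)) q≤1) (subst (_≤ 1) (sym (cong proj₂ w₁)) q′≤1)

record InsertionWeights (n i : ℕ) (X Y : Column) (a b : ℕ × ℕ) : Set where
  field
    outside  : ∀ j → 1 ≤ j → j ≤ n → j ≢ i → j ≢ suc i → W (r n Y) j ≡ W (r n X) j
    Y-at-i   : W (r n Y) i ≡ ρ (0 , 1) 0
    Y-at-suc : W (r n Y) (suc i) ≡ ρ (1 , 0) 0
    X-at-i   : W (r n X) i ≡ ρ a 0
    X-at-suc : W (r n X) (suc i) ≡ ρ b 0

insertion-weights : ∀ n i X Y {a b} → 1 ≤ i → i < n → NegativesDistinct X → NegativesDistinct Y →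
  (∀ t → t ≢ i → t ≢ suc i → profile Y t ≡ profile X t) → profile Y i ≡ (0 , 0) → profile Y (suc i) ≡ (1 , 1) →
  profile X i ≡ a → profile X (suc i) ≡ b → Single a → Single b → InsertionWeights n i X Y a b
insertion-weights n i X Y {a} {b} 1≤i i<n distinct-X distinct-Y outside wY₀ wY₁ wX₀ wX₁ single-a single-b = record
  { outside  = λ j 1≤j j≤n j≢i j≢1+i → trans
      (W-r-at n Y distinct-Y 1≤j j≤n (outside j j≢i j≢1+i)
        (trans (inserted j) (cong (λ c → bit c + tcount n X j) (≢⇒≡ᵇ-false (j≢i ∘ sym)))))
      (sym (W-r n X distinct-X 1≤j j≤n))
  ; Y-at-i   = W-r-at n Y distinct-Y 1≤i i≤n wY₀
                 (trans (inserted i) (cong₂ (λ c t → bit c + t) (≡ᵇ-refl i) (tcount-nonfree n X 1≤i nonfree-Xi)))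
  ; Y-at-suc = W-r-at n Y distinct-Y (s≤s z≤n) i<n wY₁
                 (tcount-nonfree n Y (s≤s z≤n) (trans (free-profile Y (suc i)) (cong freeᵖ wY₁)))
  ; X-at-i   = W-r-at n X distinct-X 1≤i i≤n wX₀ (tcount-nonfree n X 1≤i nonfree-Xi)
  ; X-at-suc = W-r-at n X distinct-X (s≤s z≤n) i<n wX₁
                 (tcount-nonfree n X (s≤s z≤n) (trans (free-profile X (suc i)) (trans (cong freeᵖ wX₁) (proj₁ single-b))))
  }
  where
  i≤n = <⇒≤ i<n
  nonfree-Xi = trans (free-profile X i) (trans (cong freeᵖ wX₀) (proj₁ single-a))
  inserted = insert-tcount n i X Y 1≤i i<n outside (cong freeᵖ wY₀) (cong bothᵖ wY₁)
               (subst Single (sym wX₀) single-a) (subst Single (sym wX₁) single-b)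

-- The signature rule

signed : ℕ → ℕ → Letter → Bool
signed n i x with sign n i x
... | none  = false
... | plus  = true
... | minus = true

unsigned : ∀ {n i x} → sign n i x ≡ none → signed n i x ≡ false
unsigned {n} {i} {x} eq with sign n i x
unsigned refl | none = refl

signedLetters : ℕ → ℕ → ℕ → Column → List (ℕ × Letter)
signedLetters n i p [] = []
signedLetters n i p (x ∷ xs) with sign n i x
... | none  = signedLetters n i (suc p) xs
... | plus  = (p , x) ∷ signedLetters n i (suc p) xs
... | minus = (p , x) ∷ signedLetters n i (suc p) xs

scanSigned : ℕ → ℕ → ℕ → Maybe ℕ → List (ℕ × Letter) → Maybe ℕ
scanSigned n i unmatched best [] = best
scanSigned n i unmatched best ((p , x) ∷ xs) with sign n i x
... | plus  = scanSigned n i (suc unmatched) best xs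
... | none  = scanSigned n i unmatched best xs
... | minus with unmatched
...   | zero   = scanSigned n i zero (just p) xs
...   | suc o  = scanSigned n i o best xs

scan≡scanSigned : ∀ n i p unmatched best C → scan n i p unmatched best C ≡ scanSigned n i unmatched best (signedLetters n i p C)
scan≡scanSigned n i p unmatched best [] = refl
scan≡scanSigned n i p unmatched best (x ∷ C) with sign n i x in sx
... | none  = scan≡scanSigned n i (suc p) unmatched best C
... | plus  rewrite sx = scan≡scanSigned n i (suc p) (suc unmatched) best C
... | minus with unmatched
...   | zero  rewrite sx = scan≡scanSigned n i (suc p) zero (just p) C
...   | suc o rewrite sx = scan≡scanSigned n i (suc p) o best C

signedLetters-letters : ∀ n i p C → map proj₂ (signedLetters n i p C) ≡ filterᵇ (signed n i) C
signedLetters-letters n i p [] = refl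
signedLetters-letters n i p (x ∷ C) with sign n i x
... | none  = signedLetters-letters n i (suc p) C
... | plus  = cong (x ∷_) (signedLetters-letters n i (suc p) C)
... | minus = cong (x ∷_) (signedLetters-letters n i (suc p) C)

OffsetIn : ℕ → Column → ℕ × Letter → Set
OffsetIn p C (q , y) = ∃ λ d → q ≡ p + d × nth C d ≡ just y

offset-shift : ∀ {p x C qy} → OffsetIn (suc p) C qy → OffsetIn p (x ∷ C) qy
offset-shift {p} (d , q≡ , at) = suc d , trans q≡ (sym (+-suc p d)) , at

signedLetters-offsets : ∀ n i p C → All (OffsetIn p C) (signedLetters n i p C)
signedLetters-offsets n i p [] = []
signedLetters-offsets n i p (x ∷ C) with sign n i x
... | none  = All.map offset-shift (signedLetters-offsets n i (suc p) C)
... | plus  = (0 , sym (+-identityʳ p) , refl) ∷ All.map offset-shift (signedLetters-offsets n i (suc p) C)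
... | minus = (0 , sym (+-identityʳ p) , refl) ∷ All.map offset-shift (signedLetters-offsets n i (suc p) C)

signedLetters-nth : ∀ n i C → All (λ (q , x) → nth C q ≡ just x) (signedLetters n i 0 C)
signedLetters-nth n i C = All.map (λ { (d , refl , at) → at }) (signedLetters-offsets n i 0 C)

e-scan : ∀ n i C {C'} → e n i C ≡ just C' → ∃ λ k → scan n i 0 0 nothing C ≡ just k × C' ≡ modifyAt k (change n i) C
e-scan n i C eq with scan n i 0 0 nothing C
e-scan n i C refl | just k = k , refl , refl

data Positioned : List Letter → List (ℕ × Letter) → Set where
  []  : Positioned [] []
  _∷_ : ∀ {x M S} q → Positioned M S → Positioned (x ∷ M) ((q , x) ∷ S)

positioned : ∀ S → Positioned (map proj₂ S) S
positioned []             = []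
positioned ((q , x) ∷ S) = q ∷ positioned S

signed-filter : ∀ n i {C} window → IsColumn n C → Strict n window →
  (∀ {x} → signed n i x ≡ true → x ∈ window) → (∀ {x} → x ∈ window → signed n i x ≡ true) →
  filterᵇ (signed n i) C ≡ filterᵇ (λ w → memL w C) window
signed-filter n i {C} window (_ , linked) window-strict signed⇒∈ ∈⇒signed = strict-unique n
  (filterᵇ-AllPairs (signed n i) C (Linked⇒AllPairs <-trans linked)) (filterᵇ-AllPairs _ window window-strict)
  (λ x∈ → let (x∈C , sx) = ∈-filterᵇ⁻ (signed n i) C x∈ in ∈-filterᵇ⁺ _ (signed⇒∈ sx) (∈⇒memL C x∈C))
  (λ x∈ → let (x∈W , mx) = ∈-filterᵇ⁻ _ window x∈ in ∈-filterᵇ⁺ (signed n i) (memL⇒∈ _ C mx) (∈⇒signed x∈W))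

-- Config i x p₀ p₁: e_i changes the letter x of C, whose profiles at i and i + 1 are p₀ and p₁.
data Config (i : ℕ) : Letter → ℕ × ℕ → ℕ × ℕ → Set where
  pos-alone   : Config i (pos (suc i)) (0 , 0) (1 , 0)
  pos-unpairs : Config i (pos (suc i)) (0 , 0) (1 , 1)
  pos-repairs : Config i (pos (suc i)) (0 , 1) (1 , 1)
  neg-alone   : Config i (neg i)       (0 , 1) (0 , 0)
  neg-pairs   : Config i (neg i)       (0 , 1) (1 , 0)
  neg-repairs : Config i (neg i)       (1 , 1) (1 , 0)

opt : Bool → Letter → Column → Column
opt b x xs = if b then x ∷ xs else xs

module Signature {n i : ℕ} (1≤i : 1 ≤ i) (i<n : i < n) where

  i<ᵇn : (i <ᵇ n) ≡ true
  i<ᵇn = <⇒<ᵇ-true i<n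

  sign-pos-i : sign n i (pos i) ≡ plus
  sign-pos-i rewrite ≡ᵇ-refl i = refl

  sign-pos-suc : sign n i (pos (suc i)) ≡ minus
  sign-pos-suc rewrite ≢⇒≡ᵇ-false (suc≢ i) | i<ᵇn | ≡ᵇ-refl i = refl

  sign-neg-suc : sign n i (neg (suc i)) ≡ plus
  sign-neg-suc rewrite ≢⇒≡ᵇ-false (suc≢ i) | i<ᵇn | ≡ᵇ-refl i = refl

  sign-neg-i : sign n i (neg i) ≡ minus
  sign-neg-i rewrite ≡ᵇ-refl i = refl

  window : Column
  window = pos i ∷ pos (suc i) ∷ neg (suc i) ∷ neg i ∷ []

  window-strict : Strict n window
  window-strict = Linked⇒AllPairs <-trans (≤-refl ∷ middle ∷ last ∷ [-])
    where
    middle : suc i < n + n ∸ i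
    middle = m+n≤o⇒m≤o∸n (suc (suc i)) (subst (_≤ n + n) (+-suc (suc i) i) (+-mono-≤ i<n i<n))
    last : n + n ∸ i < suc (n + n) ∸ i
    last = ∸-monoˡ-< ≤-refl (≤-trans (<⇒≤ i<n) (m≤m+n n n))

  sign-outside : ∀ {j} → j ≢ i → j ≢ suc i → sign n i (pos j) ≡ none × sign n i (neg j) ≡ none
  sign-outside j≢i j≢1+i rewrite ≢⇒≡ᵇ-false j≢i | ≢⇒≡ᵇ-false j≢1+i | ∧-zeroʳ (i <ᵇ n) = refl , refl

  signed⇒window : ∀ {x} → signed n i x ≡ true → x ∈ window
  signed⇒window {pos j} sx with j ≟ i | j ≟ suc i
  ... | yes refl | _        = here refl
  ... | no _     | yes refl = there (here refl)
  ... | no j≢i   | no j≢1+i = ⊥-elim (true≢false (trans (sym sx) (unsigned {n} {i} {pos j} (proj₁ (sign-outside j≢i j≢1+i)))))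
  signed⇒window {neg j} sx with j ≟ i | j ≟ suc i
  ... | yes refl | _        = there (there (there (here refl)))
  ... | no _     | yes refl = there (there (here refl))
  ... | no j≢i   | no j≢1+i = ⊥-elim (true≢false (trans (sym sx) (unsigned {n} {i} {neg j} (proj₂ (sign-outside j≢i j≢1+i)))))

  window⇒signed : ∀ {x} → x ∈ window → signed n i x ≡ true
  window⇒signed (here refl)                         rewrite sign-pos-i   = refl
  window⇒signed (there (here refl))                 rewrite sign-pos-suc = refl
  window⇒signed (there (there (here refl)))         rewrite sign-neg-suc = refl
  window⇒signed (there (there (there (here refl)))) rewrite sign-neg-i   = refl

  decide : ∀ a b c d {S k} → Positioned (opt a (pos i) (opt b (pos (suc i)) (opt c (neg (suc i)) (opt d (neg i) [])))) S →
    scanSigned n i 0 nothing S ≡ just k → ∃ λ x → (k , x) ∈ S × Config i x (bit a , bit d) (bit b , bit c)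
  decide false false false false []            = λ ()
  decide false false false true  (_ ∷ [])      rewrite sign-neg-i = λ { refl → _ , here refl , neg-alone }
  decide false false true  false (_ ∷ [])      rewrite sign-neg-suc = λ ()
  decide false false true  true  (_ ∷ _ ∷ [])  rewrite sign-neg-suc | sign-neg-i = λ ()
  decide false true  false false (_ ∷ [])      rewrite sign-pos-suc = λ { refl → _ , here refl , pos-alone }
  decide false true  false true  (_ ∷ _ ∷ [])  rewrite sign-pos-suc | sign-neg-i = λ { refl → _ , there (here refl) , neg-pairs }
  decide false true  true  false (_ ∷ _ ∷ [])  rewrite sign-pos-suc | sign-neg-suc = λ { refl → _ , here refl , pos-unpairs }
  decide false true  true  true  (_ ∷ _ ∷ _ ∷ []) rewrite sign-pos-suc | sign-neg-suc | sign-neg-i =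
    λ { refl → _ , here refl , pos-repairs }
  decide true  false false false (_ ∷ [])      rewrite sign-pos-i = λ ()
  decide true  false false true  (_ ∷ _ ∷ [])  rewrite sign-pos-i | sign-neg-i = λ ()
  decide true  false true  false (_ ∷ _ ∷ [])  rewrite sign-pos-i | sign-neg-suc = λ ()
  decide true  false true  true  (_ ∷ _ ∷ _ ∷ []) rewrite sign-pos-i | sign-neg-suc | sign-neg-i = λ ()
  decide true  true  false false (_ ∷ _ ∷ [])  rewrite sign-pos-i | sign-pos-suc = λ ()
  decide true  true  false true  (_ ∷ _ ∷ _ ∷ []) rewrite sign-pos-i | sign-pos-suc | sign-neg-i =
    λ { refl → _ , there (there (here refl)) , neg-repairs }
  decide true  true  true  false (_ ∷ _ ∷ _ ∷ []) rewrite sign-pos-i | sign-pos-suc | sign-neg-suc = λ ()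
  decide true  true  true  true  (_ ∷ _ ∷ _ ∷ _ ∷ []) rewrite sign-pos-i | sign-pos-suc | sign-neg-suc | sign-neg-i = λ ()

  classify : ∀ {C C'} → IsColumn n C → e n i C ≡ just C' →
    ∃ λ k → ∃ λ x → ∃ λ w₀ → ∃ λ w₁ → C' ≡ modifyAt k (change n i) C × nth C k ≡ just x
      × profile C i ≡ w₀ × profile C (suc i) ≡ w₁ × Config i x w₀ w₁
  classify {C} col step with e-scan n i C step
  ... | k , scanned , C'≡ with decide _ _ _ _ arranged (trans (sym (scan≡scanSigned n i 0 0 nothing C)) scanned)
    where
    arranged = subst (λ M → Positioned M (signedLetters n i 0 C))
      (trans (signedLetters-letters n i 0 C) (signed-filter n i window col window-strict signed⇒window window⇒signed))
      (positioned (signedLetters n i 0 C))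
  ... | x , k∈S , config = k , x , _ , _ , C'≡ , All.lookup (signedLetters-nth n i C) k∈S
                          , profile-column col i , profile-column col (suc i) , config

module SignatureAtN (n : ℕ) where

  sign-pos-n : sign n n (pos n) ≡ plus
  sign-pos-n rewrite ≡ᵇ-refl n = refl

  sign-neg-n : sign n n (neg n) ≡ minus
  sign-neg-n rewrite ≡ᵇ-refl n = refl

  sign-outside : ∀ {j} → j ≢ n → sign n n (pos j) ≡ none × sign n n (neg j) ≡ none
  sign-outside j≢n rewrite ≢⇒≡ᵇ-false j≢n | <ᵇ-irrefl n = refl , refl

  window : Column
  window = pos n ∷ neg n ∷ []

  window-strict : Strict n window
  window-strict = (n<n̄ ∷ []) ∷ [] ∷ []
    where
    n<n̄ : n < suc (n + n) ∸ n
    n<n̄ = subst (n <_) (sym (trans (+-∸-assoc 1 (m≤m+n n n)) (cong suc (m+n∸n≡m n n)))) ≤-refl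

  signed⇒window : ∀ {x} → signed n n x ≡ true → x ∈ window
  signed⇒window {pos j} sx with j ≟ n
  ... | yes refl = here refl
  ... | no j≢n   = ⊥-elim (true≢false (trans (sym sx) (unsigned {n} {n} {pos j} (proj₁ (sign-outside j≢n)))))
  signed⇒window {neg j} sx with j ≟ n
  ... | yes refl = there (here refl)
  ... | no j≢n   = ⊥-elim (true≢false (trans (sym sx) (unsigned {n} {n} {neg j} (proj₂ (sign-outside j≢n)))))

  window⇒signed : ∀ {x} → x ∈ window → signed n n x ≡ true
  window⇒signed (here refl)         rewrite sign-pos-n = refl
  window⇒signed (there (here refl)) rewrite sign-neg-n = refl

  decide : ∀ a d {S k} → Positioned (opt a (pos n) (opt d (neg n) [])) S →
    scanSigned n n 0 nothing S ≡ just k → (k , neg n) ∈ S × (bit a , bit d) ≡ (0 , 1)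
  decide false false []           = λ ()
  decide false true  (_ ∷ [])     rewrite sign-neg-n = λ { refl → here refl , refl }
  decide true  false (_ ∷ [])     rewrite sign-pos-n = λ ()
  decide true  true  (_ ∷ _ ∷ []) rewrite sign-pos-n | sign-neg-n = λ ()

  classify : ∀ {C C'} → IsColumn n C → e n n C ≡ just C' →
    ∃ λ k → C' ≡ modifyAt k (change n n) C × nth C k ≡ just (neg n) × profile C n ≡ (0 , 1)
  classify {C} col step with e-scan n n C step
  ... | k , scanned , C'≡ with decide _ _ arranged (trans (sym (scan≡scanSigned n n 0 0 nothing C)) scanned)
    where
    arranged = subst (λ M → Positioned M (signedLetters n n 0 C))
      (trans (signedLetters-letters n n 0 C) (signed-filter n n window col window-strict signed⇒window window⇒signed))
      (positioned (signedLetters n n 0 C))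
  ... | k∈S , window-profile = k , C'≡ , All.lookup (signedLetters-nth n n C) k∈S , trans (profile-column col n) window-profile

-- The effect of e_i on profiles

_⊕_ : ℕ × ℕ → ℕ × ℕ → ℕ × ℕ
(a , b) ⊕ (c , d) = a + c , b + d

⊕-cancelʳ : ∀ a b d → a ⊕ d ≡ b ⊕ d → a ≡ b
⊕-cancelʳ (a₁ , a₂) (b₁ , b₂) (d₁ , d₂) eq =
  cong₂ _,_ (+-cancelʳ-≡ d₁ a₁ b₁ (cong proj₁ eq)) (+-cancelʳ-≡ d₂ a₂ b₂ (cong proj₂ eq))

indicator : Letter → ℕ → ℕ × ℕ
indicator x j = bit (isPos j x) , bit (isNeg j x)

indicator-pos : ∀ a → indicator (pos a) a ≡ (1 , 0)
indicator-pos a rewrite ≡ᵇ-refl a = refl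

indicator-neg : ∀ a → indicator (neg a) a ≡ (0 , 1)
indicator-neg a rewrite ≡ᵇ-refl a = refl

indicator-other : ∀ x {j} → index x ≢ j → indicator x j ≡ (0 , 0)
indicator-other (pos a) a≢j rewrite ≢⇒≡ᵇ-false a≢j = refl
indicator-other (neg a) a≢j rewrite ≢⇒≡ᵇ-false a≢j = refl

profile-modifyAt : ∀ C k h {x} → nth C k ≡ just x → ∀ j →
  profile (modifyAt k h C) j ⊕ indicator x j ≡ profile C j ⊕ indicator (h x) j
profile-modifyAt C k h at-k j = cong₂ _,_ (count-modifyAt (isPos j) h k C at-k) (count-modifyAt (isNeg j) h k C at-k)

module Move (C : Column) (k : ℕ) (h : Letter → Letter) {x : Letter} (at-k : nth C k ≡ just x) where

  C′ : Column
  C′ = modifyAt k h C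

  untouched : ∀ {j} → index x ≢ j → index (h x) ≢ j → profile C′ j ≡ profile C j
  untouched {j} x≢j hx≢j = ⊕-cancelʳ _ _ (0 , 0) (trans (cong (profile C′ j ⊕_) (sym (indicator-other x x≢j)))
    (trans (profile-modifyAt C k h at-k j) (cong (profile C j ⊕_) (indicator-other (h x) hx≢j))))

  settle : ∀ {j d d′} b {a} → indicator x j ≡ d → indicator (h x) j ≡ d′ → profile C j ≡ a → b ⊕ d ≡ a ⊕ d′ → profile C′ j ≡ b
  settle {j} {d} b refl refl refl balance = ⊕-cancelʳ _ _ d (trans (profile-modifyAt C k h at-k j) (sym balance))

module Effect {n i : ℕ} (1≤i : 1 ≤ i) (i<n : i < n) {C : Column} (col : IsColumn n C) (k : ℕ) where

  C′ : Column
  C′ = modifyAt k (change n i) C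

  Goal : Set
  Goal = (wt n (r n C) ≡ wt n (r n C′)) ⊎ (wt n (r n C) ≡ s n i (wt n (r n C′)))

  distinct : NegativesDistinct C
  distinct = column-neg-≤1 col

  module Raise (at-k : nth C k ≡ just (pos (suc i))) where
    open Move C k (change n i) at-k using (untouched; settle)

    outside : ∀ t → t ≢ i → t ≢ suc i → profile C′ t ≡ profile C t
    outside t t≢i t≢1+i = untouched (t≢1+i ∘ sym) (t≢i ∘ sym)

    at-i : ∀ b {a} → profile C i ≡ a → b ⊕ (0 , 0) ≡ a ⊕ (1 , 0) → profile C′ i ≡ b
    at-i b = settle b (indicator-other (pos (suc i)) (suc≢ i)) (indicator-pos i)

    at-suc : ∀ b {a} → profile C (suc i) ≡ a → b ⊕ (1 , 0) ≡ a ⊕ (0 , 0) → profile C′ (suc i) ≡ b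
    at-suc b = settle b (indicator-pos (suc i)) (indicator-other (pos i) (suc≢ i ∘ sym))

  module Lower (at-k : nth C k ≡ just (neg i)) where
    open Move C k (change n i) at-k using (untouched; settle)

    change-neg : change n i (neg i) ≡ neg (suc i)
    change-neg rewrite <⇒<ᵇ-true i<n = refl

    outside : ∀ t → t ≢ i → t ≢ suc i → profile C′ t ≡ profile C t
    outside t t≢i t≢1+i = untouched (t≢i ∘ sym) (subst (λ y → index y ≢ t) (sym change-neg) (t≢1+i ∘ sym))

    at-i : ∀ b {a} → profile C i ≡ a → b ⊕ (0 , 1) ≡ a ⊕ (0 , 0) → profile C′ i ≡ b
    at-i b = settle b (indicator-neg i) (trans (cong (λ y → indicator y i) change-neg) (indicator-other (neg (suc i)) (suc≢ i)))

    at-suc : ∀ b {a} → profile C (suc i) ≡ a → b ⊕ (0 , 0) ≡ a ⊕ (0 , 1) → profile C′ (suc i) ≡ b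
    at-suc b = settle b (indicator-other (neg i) (suc≢ i ∘ sym))
                        (trans (cong (λ y → indicator y (suc i)) change-neg) (indicator-neg (suc i)))

  swapped : ∀ {w₀ w₁} → (∀ t → t ≢ i → t ≢ suc i → profile C′ t ≡ profile C t) →
    profile C i ≡ w₀ → profile C (suc i) ≡ w₁ → profile C′ i ≡ w₁ → profile C′ (suc i) ≡ w₀ →
    ∀ t → profile C′ t ≡ profile C (tau i t)
  swapped outside w₀ w₁ w₀′ w₁′ = tau-pointwise (profile C′) (profile C) i outside (trans w₀′ (sym w₁)) (trans w₁′ (sym w₀))

  by-swap : (∀ t → profile C′ t ≡ profile C (tau i t)) → tList n C′ ≡ map (tau i) (tList n C) → Goal
  by-swap τ-profile τ-tList = inj₂ (swap-by-profile n i C C′ 1≤i i<n distinct τ-profile τ-tList)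

  case-pos-alone : nth C k ≡ just (pos (suc i)) → profile C i ≡ (0 , 0) → profile C (suc i) ≡ (1 , 0) → Goal
  case-pos-alone at-k w₀ w₁ = by-swap τ-profile
    (conjugate-tList n i C C′ 1≤i i<n τ-profile (cong freeᵖ w₀) (cong freeᵖ w₁ , cong bothᵖ w₁))
    where
    open Raise at-k
    τ-profile = swapped outside w₀ w₁ (at-i (1 , 0) w₀ refl) (at-suc (0 , 0) w₁ refl)

  case-pos-repairs : nth C k ≡ just (pos (suc i)) → profile C i ≡ (0 , 1) → profile C (suc i) ≡ (1 , 1) → Goal
  case-pos-repairs at-k w₀ w₁ = by-swap τ-profile (relabel-tList n i C C′ 1≤i i<n τ-profile (cong freeᵖ w₀) (cong freeᵖ w₁))
    where
    open Raise at-k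
    τ-profile = swapped outside w₀ w₁ (at-i (1 , 1) w₀ refl) (at-suc (0 , 1) w₁ refl)

  case-neg-repairs : nth C k ≡ just (neg i) → profile C i ≡ (1 , 1) → profile C (suc i) ≡ (1 , 0) → Goal
  case-neg-repairs at-k w₀ w₁ = by-swap τ-profile (relabel-tList n i C C′ 1≤i i<n τ-profile (cong freeᵖ w₀) (cong freeᵖ w₁))
    where
    open Lower at-k
    τ-profile = swapped outside w₀ w₁ (at-i (1 , 0) w₀ refl) (at-suc (1 , 1) w₁ refl)

  case-neg-alone : nth C k ≡ just (neg i) → profile C i ≡ (0 , 1) → profile C (suc i) ≡ (0 , 0) → Goal
  case-neg-alone at-k w₀ w₁ = by-swap (swapped outside w₀ w₁ w₀′ w₁′) (begin
    tList n C′                             ≡⟨ sym (map-tau-involutive i (tList n C′)) ⟩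
    map (tau i) (map (tau i) (tList n C′)) ≡⟨ cong (map (tau i)) (sym conjugated) ⟩
    map (tau i) (tList n C)                ∎)
    where
    open ≡-Reasoning
    open Lower at-k
    w₀′ = at-i (0 , 0) w₀ refl
    w₁′ = at-suc (0 , 1) w₁ refl
    conjugated : tList n C ≡ map (tau i) (tList n C′)
    conjugated = conjugate-tList n i C′ C 1≤i i<n
      (tau-pointwise (profile C) (profile C′) i (λ t t≢i t≢1+i → sym (outside t t≢i t≢1+i))
                     (trans w₀ (sym w₁′)) (trans w₁ (sym w₀′)))
      (cong freeᵖ w₀′) (cong freeᵖ w₁′ , cong bothᵖ w₁′)

  case-pos-unpairs : nth C k ≡ just (pos (suc i)) → profile C i ≡ (0 , 0) → profile C (suc i) ≡ (1 , 1) → Goal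
  case-pos-unpairs at-k w₀ w₁ = inj₂ (wt-swap n i (r n C) (r n C′) 1≤i i<n
    (window-cases (λ j → 1 ≤ j → j ≤ n → W (r n C) j ≡ W (r n C′) (tau i j)) i
      (λ j j≢i j≢1+i 1≤j j≤n → trans (weights.outside j 1≤j j≤n j≢i j≢1+i)
                                     (cong (W (r n C′)) (sym (tau-other i j≢i j≢1+i))))
      (λ _ _ → trans weights.Y-at-i (trans (sym weights.X-at-suc) (cong (W (r n C′)) (sym (tau-i i)))))
      (λ _ _ → trans weights.Y-at-suc (trans (sym weights.X-at-i) (cong (W (r n C′)) (sym (tau-suc i)))))))
    where
    open Raise at-k
    w₀′ = at-i (1 , 0) w₀ refl
    w₁′ = at-suc (0 , 1) w₁ refl
    module weights = InsertionWeights (insertion-weights n i C′ C 1≤i i<n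
      (distinct-window C C′ i distinct outside w₀′ w₁′ z≤n (s≤s z≤n)) distinct
      (λ t t≢i t≢1+i → sym (outside t t≢i t≢1+i)) w₀ w₁ w₀′ w₁′ (refl , refl) (refl , refl))

  case-neg-pairs : nth C k ≡ just (neg i) → profile C i ≡ (0 , 1) → profile C (suc i) ≡ (1 , 0) → Goal
  case-neg-pairs at-k w₀ w₁ = inj₁ (wt-cong n (r n C) (r n C′)
    (window-cases (λ j → 1 ≤ j → j ≤ n → W (r n C) j ≡ W (r n C′) j) i
      (λ j j≢i j≢1+i 1≤j j≤n → sym (weights.outside j 1≤j j≤n j≢i j≢1+i))
      (λ _ _ → trans weights.X-at-i (sym weights.Y-at-i))
      (λ _ _ → trans weights.X-at-suc (sym weights.Y-at-suc))))
    where
    open Lower at-k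
    w₀′ = at-i (0 , 0) w₀ refl
    w₁′ = at-suc (1 , 1) w₁ refl
    module weights = InsertionWeights (insertion-weights n i C C′ 1≤i i<n distinct
      (distinct-window C C′ i distinct outside w₀′ w₁′ z≤n (s≤s z≤n)) outside w₀′ w₁′ w₀ w₁ (refl , refl) (refl , refl))

  step-weights : ∀ {x w₀ w₁} → Config i x w₀ w₁ → nth C k ≡ just x → profile C i ≡ w₀ → profile C (suc i) ≡ w₁ → Goal
  step-weights pos-alone   = case-pos-alone
  step-weights pos-unpairs = case-pos-unpairs
  step-weights pos-repairs = case-pos-repairs
  step-weights neg-alone   = case-neg-alone
  step-weights neg-pairs   = case-neg-pairs
  step-weights neg-repairs = case-neg-repairs

module EffectAtN {n : ℕ} (1≤n : 1 ≤ n) {C : Column} (col : IsColumn n C) (k : ℕ)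
                  (at-k : nth C k ≡ just (neg n)) (w : profile C n ≡ (0 , 1)) where
  open Move C k (change n n) at-k

  change-neg : change n n (neg n) ≡ pos n
  change-neg rewrite <ᵇ-irrefl n = refl

  outside : ∀ t → t ≢ n → profile C′ t ≡ profile C t
  outside t t≢n = untouched (t≢n ∘ sym) (subst (λ y → index y ≢ t) (sym change-neg) (t≢n ∘ sym))

  w′ : profile C′ n ≡ (1 , 0)
  w′ = settle (1 , 0) (indicator-neg n) (trans (cong (λ y → indicator y n) change-neg) (indicator-pos n)) w refl

  same-kind : ∀ t → freeᵖ (profile C′ t) ≡ freeᵖ (profile C t) × bothᵖ (profile C′ t) ≡ bothᵖ (profile C t)
  same-kind t with t ≟ n
  ... | yes t≡n = trans (cong freeᵖ at-n′) (sym (cong freeᵖ at-n)) , trans (cong bothᵖ at-n′) (sym (cong bothᵖ at-n))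
    where
    at-n  = trans (cong (profile C) t≡n) w
    at-n′ = trans (cong (profile C′) t≡n) w′
  ... | no t≢n   = cong freeᵖ (outside t t≢n) , cong bothᵖ (outside t t≢n)

  same-tList : tList n C′ ≡ tList n C
  same-tList = cong (map proj₂) (trans (pairsFrom-cong C C′ same-free (suc n) (zs n C′))
                                       (cong (pairsFrom C (suc n)) (zs-cong n C C′ same-pairs)))
    where
    same-free : ∀ t → free t C′ ≡ free t C
    same-free t = trans (free-profile C′ t) (trans (proj₁ (same-kind t)) (sym (free-profile C t)))
    same-pairs : ∀ z → hasBoth C′ z ≡ hasBoth C z
    same-pairs z = trans (hasBoth-profile C′ z) (trans (proj₂ (same-kind z)) (sym (hasBoth-profile C z)))

  distinct : NegativesDistinct C
  distinct = column-neg-≤1 col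

  distinct′ : NegativesDistinct C′
  distinct′ t with t ≟ n
  ... | yes t≡n = subst (_≤ 1) (sym (cong proj₂ (trans (cong (profile C′) t≡n) w′))) z≤n
  ... | no t≢n   = subst (_≤ 1) (sym (cong proj₂ (outside t t≢n))) (distinct t)

  negated : wt n (r n C) ≡ s n n (wt n (r n C′))
  negated = wt-negate-last n (r n C) (r n C′) 1≤n
    (λ j 1≤j j<n → trans (W-r n C distinct 1≤j (<⇒≤ j<n))
      (sym (W-r-at n C′ distinct′ 1≤j (<⇒≤ j<n) (outside j (λ j≡n → <-irrefl j≡n j<n)) (cong (multiplicity j) same-tList))))
    (trans (W-r-at n C distinct 1≤n ≤-refl w (tcount-nonfree n C 1≤n (trans (free-profile C n) (cong freeᵖ w))))
      (cong ℤ.-_ (sym (W-r-at n C′ distinct′ 1≤n ≤-refl w′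
                         (tcount-nonfree n C′ 1≤n (trans (free-profile C′ n) (cong freeᵖ w′)))))))

corollary4p14 : (n i : ℕ) (C C' : Column) → 1 ≤ i → i ≤ n →
    IsColumn n C → Admissible n C → e n i C ≡ just C' →
    (wt n (r n C) ≡ wt n (r n C')) ⊎ (wt n (r n C) ≡ s n i (wt n (r n C')))
corollary4p14 n i C C' 1≤i i≤n col _ step with m≤n⇒m<n∨m≡n i≤n
... | inj₁ i<n with Signature.classify 1≤i i<n col step
...   | k , _ , _ , _ , refl , at-k , w₀ , w₁ , config = Effect.step-weights 1≤i i<n col k config at-k w₀ w₁
corollary4p14 n n C C' 1≤n _ col _ step | inj₂ refl with SignatureAtN.classify n col step
...   | k , refl , at-k , w = inj₂ (EffectAtN.negated 1≤n col k at-k w)
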